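{- Let $k\ge 1$ be an integer and let $T_k(z)=\sum_{i\ge 0}|\mathcal{M}_{F_{k,i}}|\,z^i$ be the generating function of $k$-Fibonacci paths by length. Then, as formal power series, \[ T_k(z)=\frac{1-(k+1)z-z^2-\sqrt{(1-(k+1)z-z^2)^2-4z^2(1-kz-z^2)^2}}{2z^2(1-kz-z^2)} =\cfrac{1}{1-\frac{z}{1-kz-z^2}-\cfrac{z^2}{1-\frac{z}{1-kz-z^2}- \cfrac{z^2}{1-\frac{z}{1-kz-z^2} -\cfrac{z^2}{\ddots}}}}, \] and for every integer $t\ge 0$, \[ [z^t]\,T_k(z)=\sum_{n=0}^{t}\sum_{m=0}^{t-2n}\binom{m+2n}{m}C_n\,F_{k,t-2n-m+1}^{(m)} . \]
   Context: For a positive integer $k$, the $k$-Fibonacci numbers are defined by $F_{k,0}=0$, $F_{k,1}=1$, $F_{k,n+1}=kF_{k,n}+F_{k,n-1}$ for $n\ge1$; their generating function is $\sum_n F_{k,n}x^n=\frac{x}{1-kx-x^2}$. A $k$-Fibonacci path of length $n$ is a lattice path in $\mathbb{Z}\times\mathbb{Z}$ from $(0,0)$ to $(n,0)$ that never passes below the $x$-axis, built from rise steps $U=(1,1)$, fall steps $D=(1,-1)$, and horizontal steps $H_l=(l,0)$ for any positive integer $l$, where each step $H_l$ is additionally assigned one of $F_{k,l}$ colors (paths with the same steps but different colorings are counted as different). $\mathcal{M}_{F_{k,n}}$ denotes the set of such (colored) paths of length $n$; the empty path is the unique one of length $0$. $C_n=\frac{1}{n+1}\binom{2n}{n}$ is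 the $n$-th Catalan number. The convolved $k$-Fibonacci numbers $F^{(r)}_{k,j}$ (for integers $r\ge0$, $j\ge1$) are defined by $(1-kx-x^2)^{ -r}=\sum_{j\ge0}F^{(r)}_{k,j+1}x^j$ (so $F^{(0)}_{k,1}=1$ and $F^{(0)}_{k,j}=0$ for $j\ge2$). The square root denotes the formal power series square root with constant term $1$, and the infinite continued fraction is understood as the limit (in the formal power series topology) of its finite truncations. -}

module Defs where

open import Data.Nat as ℕ using (ℕ; zero; suc; _∸_; _≤ᵇ_; _≡ᵇ_)
open import Data.Nat.DivMod using (_/_)
open import Data.Nat.Combinatorics using (_C_)
open import Data.Integer as ℤ using (ℤ; +_; -_; _+_; _*_; _-_)
open import Data.Fin using (Fin)
open import Data.List using (List; []; _∷_)
open import Data.Bool using (Bool; true; false; _∧_; T; if_then_else_)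
open import Data.Product using (Σ)

fib : ℕ → ℕ → ℕ
fib k zero = 0
fib k (suc zero) = 1
fib k (suc (suc n)) = k ℕ.* fib k (suc n) ℕ.+ fib k n

-- A step. `H l c` is the horizontal step H_{l+1} = (l+1, 0) (so its length
-- is positive) carrying colour c, one of the F_{k,l+1} colours.
data Step (k : ℕ) : Set where
  U : Step k
  D : Step k
  H : (l : ℕ) → Fin (fib k (suc l)) → Step k

stepLen : ∀ {k} → Step k → ℕ
stepLen U = 1
stepLen D = 1
stepLen (H l _) = suc l

pathLen : ∀ {k} → List (Step k) → ℕ
pathLen [] = 0
pathLen (s ∷ ss) = stepLen s ℕ.+ pathLen ss

valid : ∀ {k} → ℕ → List (Step k) → Bool
valid zero [] = true
valid (suc h) [] = false
valid h (U ∷ ss) = valid (suc h) ss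
valid zero (D ∷ ss) = false
valid (suc h) (D ∷ ss) = valid h ss
valid h (H _ _ ∷ ss) = valid h ss

KFibPath : ℕ → ℕ → Set
KFibPath k n = Σ (List (Step k)) (λ ss → T (valid 0 ss ∧ (pathLen ss ≡ᵇ n)))

FPS : Set
FPS = ℕ → ℤ

sumTo : ℕ → (ℕ → ℤ) → ℤ
sumTo zero f = f 0
sumTo (suc n) f = sumTo n f + f (suc n)

_⊕_ : FPS → FPS → FPS
(f ⊕ g) n = f n + g n

_⊖_ : FPS → FPS → FPS
(f ⊖ g) n = f n - g n

_⊛_ : FPS → FPS → FPS
(f ⊛ g) n = sumTo n (λ i → f i * g (n ∸ i))

infixl 6 _⊕_ _⊖_
infixl 7 _⊛_

poly : List ℤ → FPS
poly [] n = + 0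
poly (c ∷ cs) zero = c
poly (c ∷ cs) (suc n) = poly cs n

zeroS oneS X : FPS
zeroS = poly []
oneS = poly (+ 1 ∷ [])
X = poly (+ 0 ∷ + 1 ∷ [])

powS : FPS → ℕ → FPS
powS f zero = oneS
powS f (suc r) = f ⊛ powS f r

-- Multiplicative inverse of a power series with constant term 1:
-- b_0 = 1,  b_{n+1} = - Σ_{j=1}^{n+1} f_j b_{n+1-j}.
-- (Only meaningful, and only used, when f 0 = 1.)
idx : List ℤ → ℕ → ℤ
idx [] _ = + 0
idx (x ∷ xs) zero = x
idx (x ∷ xs) (suc i) = idx xs i

-- invRev f n = [b_n, b_{n-1}, ..., b_0]
invRev : FPS → ℕ → List ℤ
invRev f zero = + 1 ∷ []
invRev f (suc n) =
  (- sumTo n (λ i → f (suc i) * idx (invRev f n) i)) ∷ invRev f n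

inv : FPS → FPS
inv f n = idx (invRev f n) 0

Bk : ℕ → FPS
Bk k = poly (+ 1 ∷ - (+ k) ∷ - (+ 1) ∷ [])

Ak : ℕ → FPS
Ak k = poly (+ 1 ∷ - (+ suc k) ∷ - (+ 1) ∷ [])

Z2 : FPS
Z2 = poly (+ 0 ∷ + 0 ∷ + 1 ∷ [])

Disc : ℕ → FPS
Disc k = Ak k ⊛ Ak k ⊖ poly (+ 4 ∷ []) ⊛ Z2 ⊛ Bk k ⊛ Bk k

Denom : ℕ → FPS
Denom k = poly (+ 2 ∷ []) ⊛ Z2 ⊛ Bk k

Wk : ℕ → FPS
Wk k = X ⊛ inv (Bk k)

cfTrunc : ℕ → ℕ → FPS
cfTrunc k zero = zeroS
cfTrunc k (suc n) = inv (oneS ⊖ Wk k ⊖ Z2 ⊛ cfTrunc k n)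

catalan : ℕ → ℕ
catalan n = ((2 ℕ.* n) C n) / suc n

-- convolved k-Fibonacci numbers: (1-kx-x^2)^{-r} = Σ_{j≥0} F^{(r)}_{k,j+1} x^j
-- (defined for j ≥ 1; the value at j = 0 is irrelevant and never used)
convFib : ℕ → ℕ → ℕ → ℤ
convFib k r j = powS (inv (Bk k)) r (j ∸ 1)

-- Σ_{n=0}^{t} Σ_{m=0}^{t-2n} binom(m+2n, m) C_n F^{(m)}_{k,t-2n-m+1},
-- where terms with 2n > t (empty inner sum) contribute 0.
coeffFormula : ℕ → ℕ → ℤ
coeffFormula k t =
  sumTo t (λ n →
    if (2 ℕ.* n) ≤ᵇ t
    then sumTo (t ∸ 2 ℕ.* n) (λ m →
           + ((m ℕ.+ 2 ℕ.* n) C m) * + catalan n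
             * convFib k m (t ∸ 2 ℕ.* n ∸ m ℕ.+ 1))
    else + 0)

-- A k-Fibonacci path is empty, or a coloured step H_l followed by a path, or U P D Q
-- with P and Q paths (split at the first return to the axis). Hence T = 1 + F T + z² T²
-- where F = z / (1 - kz - z²) is the k-Fibonacci series. Multiplying by B = 1 - kz - z²
-- gives z² B T² - (B - z) T + B = 0, so A - 2z² B T is a square root of the discriminant
-- with constant term 1, and it is the only one because ℤ[[z]] has no zero divisors. The
-- same equation reads T = 1 / (1 - F - z² T), and each level of the continued fraction
-- fixes two more coefficients. Finally, with u = 1 / (1 - F), the series u C(z² u²) also
-- solves it, where the Catalan series C = 1 + z C² is obtained from the recurrence
-- (n + 2) C_{n+1} = (4n + 2) C_n; expanding u^{2n+1} = Σ_m binom(m + 2n, m) F^m and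
-- F^m = z^m B^{-m} gives the coefficient formula.

module Submission where

open import Defs
open import Data.Nat as ℕ using (ℕ; zero; suc; _∸_; _≤_; _<_; z≤n; s≤s; _≤ᵇ_)
import Data.Nat.Properties as ℕP
open import Data.Nat.Induction using (<-rec)
open import Data.Integer as ℤ using (ℤ; +_; -_; _+_; _*_; _-_)
import Data.Integer.Properties as ℤP
open import Data.Nat.Combinatorics using (_C_; nC1≡n; nCn≡1; nCk≡nC[n∸k]; nCk+nC[k+1]≡[n+1]C[k+1])
open import Data.Nat.DivMod using (_/_; m*n/n≡m)
import Data.Nat.Tactic.RingSolver as ℕ-Solver
open import Data.Integer.Tactic.RingSolver using (solve-∀)
open import Data.List using (List; []; _∷_; _++_)
open import Data.Maybe using (Maybe; just; nothing)
open import Data.Product using (Σ; _×_; _,_; proj₁; proj₂; ∃-syntax)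
open import Data.Sum using (_⊎_; inj₁; inj₂)
open import Data.Empty using (⊥; ⊥-elim)
open import Data.Unit using (⊤; tt)
open import Data.Bool using (T; true; false; if_then_else_)
open import Data.Bool.Properties using (T-irrelevant; T-∧)
open import Data.Fin as Fin using (Fin)
open import Data.Fin.Properties using (+↔⊎; *↔×)
open import Data.Fin.Permutation using (↔⇒≡)
open import Data.Sum.Function.Propositional using (_⊎-↔_)
open import Data.Product.Function.NonDependent.Propositional using (_×-↔_)
open import Function.Properties.Inverse using (↔-refl; ↔-sym; ↔-trans)
open import Function using (_∘_; _↔_; mk↔ₛ′; Equivalence)
open import Relation.Nullary using (¬_; yes; no)
open import Relation.Binary.PropositionalEquality
open import Algebra.Bundles using (CommutativeRing)
open import Algebra.Structures using (IsCommutativeRing)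
open import Algebra.Solver.Ring.AlmostCommutativeRing
  using (fromCommutativeRing; _-Raw-AlmostCommutative⟶_)
import Algebra.Solver.Ring as RingSolver
import Relation.Binary.Reasoning.Setoid as SetoidReasoning


sumTo-cong : ∀ n {f g : ℕ → ℤ} → (∀ i → i ≤ n → f i ≡ g i) → sumTo n f ≡ sumTo n g
sumTo-cong zero     f≡g = f≡g 0 z≤n
sumTo-cong (suc n) f≡g =
  cong₂ _+_ (sumTo-cong n (λ i i≤n → f≡g i (ℕP.m≤n⇒m≤1+n i≤n))) (f≡g (suc n) ℕP.≤-refl)

sumTo-ext : ∀ n {f g : ℕ → ℤ} → (∀ i → f i ≡ g i) → sumTo n f ≡ sumTo n g
sumTo-ext n f≡g = sumTo-cong n (λ i _ → f≡g i)

sumTo-+ : ∀ n (f g : ℕ → ℤ) → sumTo n (λ i → f i + g i) ≡ sumTo n f + sumTo n g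
sumTo-+ zero    f g = refl
sumTo-+ (suc n) f g = trans (cong (_+ (f (suc n) + g (suc n))) (sumTo-+ n f g))
                            (interchange (sumTo n f) (sumTo n g) (f (suc n)) (g (suc n)))
  where
  interchange : ∀ a b c d → (a + b) + (c + d) ≡ (a + c) + (b + d)
  interchange = solve-∀

sumTo-*ˡ : ∀ n c (f : ℕ → ℤ) → sumTo n (λ i → c * f i) ≡ c * sumTo n f
sumTo-*ˡ zero    c f = refl
sumTo-*ˡ (suc n) c f = trans (cong (_+ c * f (suc n)) (sumTo-*ˡ n c f))
                             (sym (ℤP.*-distribˡ-+ c (sumTo n f) (f (suc n))))

sumTo-neg : ∀ n (f : ℕ → ℤ) → sumTo n (λ i → - f i) ≡ - sumTo n f
sumTo-neg zero    f = refl
sumTo-neg (suc n) f = trans (cong (_+ - f (suc n)) (sumTo-neg n f))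
                            (sym (ℤP.neg-distrib-+ (sumTo n f) (f (suc n))))

sumTo-zero : ∀ n (f : ℕ → ℤ) → (∀ i → i ≤ n → f i ≡ + 0) → sumTo n f ≡ + 0
sumTo-zero zero    f f≡0 = f≡0 0 z≤n
sumTo-zero (suc n) f f≡0 =
  cong₂ _+_ (sumTo-zero n f (λ i i≤n → f≡0 i (ℕP.m≤n⇒m≤1+n i≤n))) (f≡0 (suc n) ℕP.≤-refl)

sumTo-head : ∀ n (f : ℕ → ℤ) → sumTo (suc n) f ≡ f 0 + sumTo n (f ∘ suc)
sumTo-head zero    f = refl
sumTo-head (suc n) f = trans (cong (_+ f (suc (suc n))) (sumTo-head n f))
                             (ℤP.+-assoc (f 0) _ _)

sumTo-reverse : ∀ n (f : ℕ → ℤ) → sumTo n f ≡ sumTo n (λ i → f (n ∸ i))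
sumTo-reverse zero    f = refl
sumTo-reverse (suc n) f = begin
  sumTo n f + f (suc n)                 ≡⟨ cong (_+ f (suc n)) (sumTo-reverse n f) ⟩
  sumTo n (λ i → f (n ∸ i)) + f (suc n) ≡⟨ ℤP.+-comm _ (f (suc n)) ⟩
  f (suc n) + sumTo n (λ i → f (n ∸ i)) ≡⟨ sym (sumTo-head n (λ i → f (suc n ∸ i))) ⟩
  sumTo (suc n) (λ i → f (suc n ∸ i))   ∎
  where open ≡-Reasoning

sumTo-swap : ∀ n m (f : ℕ → ℕ → ℤ) →
             sumTo n (λ i → sumTo m (f i)) ≡ sumTo m (λ j → sumTo n (λ i → f i j))
sumTo-swap zero    m f = refl
sumTo-swap (suc n) m f = trans (cong (_+ sumTo m (f (suc n))) (sumTo-swap n m f))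
                               (sym (sumTo-+ m _ _))

sumTo-single : ∀ n j (f : ℕ → ℤ) → j ≤ n → (∀ i → i ≤ n → i ≢ j → f i ≡ + 0) →
               sumTo n f ≡ f j
sumTo-single zero    zero    f _ _ = refl
sumTo-single (suc n) j       f j≤1+n f≡0 with j ℕP.≟ suc n
... | yes refl = trans (cong (_+ f (suc n)) (sumTo-zero n f others)) (ℤP.+-identityˡ _)
  where
  others : ∀ i → i ≤ n → f i ≡ + 0
  others i i≤n = f≡0 i (ℕP.m≤n⇒m≤1+n i≤n) (ℕP.<⇒≢ (s≤s i≤n))
... | no j≢1+n = trans (cong₂ _+_ (sumTo-single n j f j≤n (λ i i≤n → f≡0 i (ℕP.m≤n⇒m≤1+n i≤n)))
                                  (f≡0 (suc n) ℕP.≤-refl (j≢1+n ∘ sym)))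
                       (ℤP.+-identityʳ (f j))
  where
  j≤n : j ≤ n
  j≤n = ℕP.≤-pred (ℕP.≤∧≢⇒< j≤1+n j≢1+n)

sumTo-first : ∀ n (f : ℕ → ℤ) → (∀ i → 0 < i → f i ≡ + 0) → sumTo n f ≡ f 0
sumTo-first n f f≡0 = sumTo-single n 0 f z≤n (λ i _ i≢0 → f≡0 i (ℕP.n≢0⇒n>0 i≢0))

sumTo-last : ∀ n (f : ℕ → ℤ) → (∀ i → i < n → f i ≡ + 0) → sumTo n f ≡ f n
sumTo-last n f f≡0 = sumTo-single n n f ℕP.≤-refl (λ i i≤n i≢n → f≡0 i (ℕP.≤∧≢⇒< i≤n i≢n))

sumTo-extend : ∀ t N (f : ℕ → ℤ) → t ≤ N → (∀ i → t < i → f i ≡ + 0) → sumTo N f ≡ sumTo t f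
sumTo-extend t N f t≤N f≡0 with ℕP.m≤n⇒m<n∨m≡n t≤N
... | inj₂ refl = refl
sumTo-extend t (suc N) f _ f≡0 | inj₁ (s≤s t≤N) =
  trans (cong₂ _+_ (sumTo-extend t N f t≤N f≡0) (f≡0 (suc N) (s≤s t≤N))) (ℤP.+-identityʳ (sumTo t f))

-- The ring of formal power series

shiftS : FPS → FPS
shiftS f n = f (suc n)

negS : FPS → FPS
negS f n = - f n

constS : ℤ → FPS
constS c = poly (c ∷ [])

infixr 8 _•_
_•_ : ℤ → FPS → FPS
(c • f) n = c * f n

⊛-cong : ∀ {f f′ g g′} → f ≗ f′ → g ≗ g′ → f ⊛ g ≗ f′ ⊛ g′
⊛-cong f≗f′ g≗g′ n = sumTo-ext n (λ i → cong₂ _*_ (f≗f′ i) (g≗g′ (n ∸ i)))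

⊕-cong : ∀ {f f′ g g′} → f ≗ f′ → g ≗ g′ → f ⊕ g ≗ f′ ⊕ g′
⊕-cong f≗f′ g≗g′ n = cong₂ _+_ (f≗f′ n) (g≗g′ n)

⊖-cong : ∀ {f f′ g g′} → f ≗ f′ → g ≗ g′ → f ⊖ g ≗ f′ ⊖ g′
⊖-cong f≗f′ g≗g′ n = cong₂ _-_ (f≗f′ n) (g≗g′ n)

⊛-comm : ∀ f g → f ⊛ g ≗ g ⊛ f
⊛-comm f g n = trans (sumTo-reverse n _) (sumTo-cong n swap)
  where
  swap : ∀ i → i ≤ n → f (n ∸ i) * g (n ∸ (n ∸ i)) ≡ g i * f (n ∸ i)
  swap i i≤n = trans (ℤP.*-comm (f (n ∸ i)) _) (cong (λ j → g j * f (n ∸ i)) (ℕP.m∸[m∸n]≡n i≤n))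

⊛-identityˡ : ∀ f → oneS ⊛ f ≗ f
⊛-identityˡ f n = trans (sumTo-first n _ higher) (ℤP.*-identityˡ (f n))
  where
  higher : ∀ i → 0 < i → oneS i * f (n ∸ i) ≡ + 0
  higher (suc i) _ = refl

⊛-identityʳ : ∀ f → f ⊛ oneS ≗ f
⊛-identityʳ f n = trans (⊛-comm f oneS n) (⊛-identityˡ f n)

⊛-zeroʳ : ∀ f → f ⊛ zeroS ≗ zeroS
⊛-zeroʳ f n = sumTo-zero n _ (λ i _ → ℤP.*-zeroʳ (f i))

⊛-zeroˡ : ∀ f → zeroS ⊛ f ≗ zeroS
⊛-zeroˡ f n = trans (⊛-comm zeroS f n) (⊛-zeroʳ f n)

⊛-distribʳ : ∀ f g h → (f ⊕ g) ⊛ h ≗ f ⊛ h ⊕ g ⊛ h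
⊛-distribʳ f g h n =
  trans (sumTo-ext n (λ i → ℤP.*-distribʳ-+ (h (n ∸ i)) (f i) (g i))) (sumTo-+ n _ _)

⊛-distribˡ : ∀ f g h → f ⊛ (g ⊕ h) ≗ f ⊛ g ⊕ f ⊛ h
⊛-distribˡ f g h n = trans (⊛-comm f (g ⊕ h) n)
  (trans (⊛-distribʳ g h f n) (cong₂ _+_ (⊛-comm g f n) (⊛-comm h f n)))

•-⊛ : ∀ c f g → (c • f) ⊛ g ≗ c • (f ⊛ g)
•-⊛ c f g n = trans (sumTo-ext n (λ i → ℤP.*-assoc c (f i) (g (n ∸ i)))) (sumTo-*ˡ n c _)

⊛-suc : ∀ f g n → (f ⊛ g) (suc n) ≡ f 0 * g (suc n) + (shiftS f ⊛ g) n
⊛-suc f g n = sumTo-head n _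

⊛-assoc : ∀ f g h → (f ⊛ g) ⊛ h ≗ f ⊛ (g ⊛ h)
⊛-assoc f g h zero    = ℤP.*-assoc (f 0) (g 0) (h 0)
⊛-assoc f g h (suc n) = begin
  ((f ⊛ g) ⊛ h) (suc n)
    ≡⟨ ⊛-suc (f ⊛ g) h n ⟩
  f 0 * g 0 * h (suc n) + (shiftS (f ⊛ g) ⊛ h) n
    ≡⟨ cong (λ x → f 0 * g 0 * h (suc n) + x) (begin
      (shiftS (f ⊛ g) ⊛ h) n
        ≡⟨ ⊛-cong {g = h} (⊛-suc f g) (λ _ → refl) n ⟩
      ((f 0 • shiftS g ⊕ shiftS f ⊛ g) ⊛ h) n
        ≡⟨ ⊛-distribʳ (f 0 • shiftS g) (shiftS f ⊛ g) h n ⟩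
      ((f 0 • shiftS g) ⊛ h) n + ((shiftS f ⊛ g) ⊛ h) n
        ≡⟨ cong₂ _+_ (•-⊛ (f 0) (shiftS g) h n) (⊛-assoc (shiftS f) g h n) ⟩
      f 0 * (shiftS g ⊛ h) n + (shiftS f ⊛ (g ⊛ h)) n ∎) ⟩
  f 0 * g 0 * h (suc n) + (f 0 * (shiftS g ⊛ h) n + (shiftS f ⊛ (g ⊛ h)) n)
    ≡⟨ regroup (f 0) (g 0) (h (suc n)) _ _ ⟩
  f 0 * (g 0 * h (suc n) + (shiftS g ⊛ h) n) + (shiftS f ⊛ (g ⊛ h)) n
    ≡⟨ cong (λ x → f 0 * x + (shiftS f ⊛ (g ⊛ h)) n) (sym (⊛-suc g h n)) ⟩
  f 0 * (g ⊛ h) (suc n) + (shiftS f ⊛ (g ⊛ h)) n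
    ≡⟨ sym (⊛-suc f (g ⊛ h) n) ⟩
  (f ⊛ (g ⊛ h)) (suc n) ∎
  where
  open ≡-Reasoning
  regroup : ∀ a b c d e → a * b * c + (a * d + e) ≡ a * (b * c + d) + e
  regroup = solve-∀

FPS-isCommutativeRing : IsCommutativeRing _≗_ _⊕_ _⊛_ negS zeroS oneS
FPS-isCommutativeRing = record
  { isRing = record
    { +-isAbelianGroup = record
      { isGroup = record
        { isMonoid = record
          { isSemigroup = record
            { isMagma = record
              { isEquivalence = record
                { refl = λ _ → refl ; sym = λ p n → sym (p n) ; trans = λ p q n → trans (p n) (q n) }
              ; ∙-cong = ⊕-cong }
            ; assoc = λ f g h n → ℤP.+-assoc (f n) (g n) (h n) }
          ; identity = (λ f n → ℤP.+-identityˡ (f n)) , (λ f n → ℤP.+-identityʳ (f n)) }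
        ; inverse = (λ f n → ℤP.+-inverseˡ (f n)) , (λ f n → ℤP.+-inverseʳ (f n))
        ; ⁻¹-cong = λ p n → cong -_ (p n) }
      ; comm = λ f g n → ℤP.+-comm (f n) (g n) }
    ; *-cong = ⊛-cong
    ; *-assoc = ⊛-assoc
    ; *-identity = ⊛-identityˡ , ⊛-identityʳ
    ; distrib = ⊛-distribˡ , (λ h f g → ⊛-distribʳ f g h) }
  ; *-comm = ⊛-comm }

FPS-commutativeRing : CommutativeRing _ _
FPS-commutativeRing = record { isCommutativeRing = FPS-isCommutativeRing }

constS-⊛-constS : ∀ a b → constS (a * b) ≗ constS a ⊛ constS b
constS-⊛-constS a b zero    = refl
constS-⊛-constS a b (suc n) = sym (sumTo-zero (suc n) _ vanish)
  where
  vanish : ∀ i → i ≤ suc n → constS a i * constS b (suc n ∸ i) ≡ + 0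
  vanish zero    _ = ℤP.*-zeroʳ a
  vanish (suc i) _ = refl

constS-homomorphism : ℤ.+-*-rawRing -Raw-AlmostCommutative⟶ fromCommutativeRing FPS-commutativeRing
constS-homomorphism = record
  { ⟦_⟧    = constS
  ; +-homo = λ { a b zero → refl ; a b (suc n) → refl }
  ; *-homo = constS-⊛-constS
  ; -‿homo = λ { a zero → refl ; a (suc n) → refl }
  ; 0-homo = λ { zero → refl ; (suc n) → refl }
  ; 1-homo = λ _ → refl }

constS-≟ : ∀ a b → Maybe (constS a ≗ constS b)
constS-≟ a b with a ℤ.≟ b
... | yes refl = just (λ _ → refl)
... | no _     = nothing

module FPS-Solver =
  RingSolver ℤ.+-*-rawRing (fromCommutativeRing FPS-commutativeRing) constS-homomorphism constS-≟
open FPS-Solver using (solve; _:=_; _:+_; _:*_; _:-_; :-_; con)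

module ≗-Reasoning = SetoidReasoning (CommutativeRing.setoid FPS-commutativeRing)

X-⊛-suc : ∀ f n → (X ⊛ f) (suc n) ≡ f n
X-⊛-suc f n = trans (sumTo-single (suc n) 1 _ (s≤s z≤n) vanish) (ℤP.*-identityˡ (f n))
  where
  vanish : ∀ i → i ≤ suc n → i ≢ 1 → X i * f (suc n ∸ i) ≡ + 0
  vanish zero          _ _   = refl
  vanish (suc zero)    _ i≢1 = ⊥-elim (i≢1 refl)
  vanish (suc (suc i)) _ _   = refl

Z2≗X⊛X : Z2 ≗ X ⊛ X
Z2≗X⊛X zero          = refl
Z2≗X⊛X (suc zero)    = refl
Z2≗X⊛X (suc (suc n)) = sym (X-⊛-suc X (suc n))

Z2-⊛-suc-suc : ∀ f n → (Z2 ⊛ f) (suc (suc n)) ≡ f n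
Z2-⊛-suc-suc f n = begin
  (Z2 ⊛ f) (2 ℕ.+ n)      ≡⟨ ⊛-cong {g = f} Z2≗X⊛X (λ _ → refl) (2 ℕ.+ n) ⟩
  ((X ⊛ X) ⊛ f) (2 ℕ.+ n) ≡⟨ ⊛-assoc X X f (2 ℕ.+ n) ⟩
  (X ⊛ (X ⊛ f)) (2 ℕ.+ n) ≡⟨ X-⊛-suc (X ⊛ f) (suc n) ⟩
  (X ⊛ f) (suc n)         ≡⟨ X-⊛-suc f n ⟩
  f n                     ∎
  where open ≡-Reasoning

constS-⊛ : ∀ c f → constS c ⊛ f ≗ c • f
constS-⊛ c f n = sumTo-first n _ higher
  where
  higher : ∀ i → 0 < i → constS c i * f (n ∸ i) ≡ + 0
  higher (suc i) _ = refl

idx-invRev : ∀ f n i → i ≤ n → idx (invRev f n) i ≡ inv f (n ∸ i)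
idx-invRev f zero    zero    _         = refl
idx-invRev f (suc n) zero    _         = refl
idx-invRev f (suc n) (suc i) (s≤s i≤n) = idx-invRev f n i i≤n

inv-suc : ∀ f n → inv f (suc n) ≡ - (shiftS f ⊛ inv f) n
inv-suc f n = cong -_ (sumTo-cong n (λ i i≤n → cong (f (suc i) *_) (idx-invRev f n i i≤n)))

⊛-inverseʳ : ∀ f → f 0 ≡ + 1 → f ⊛ inv f ≗ oneS
⊛-inverseʳ f f0≡1 zero    = cong (_* + 1) f0≡1
⊛-inverseʳ f f0≡1 (suc n) = begin
  (f ⊛ inv f) (suc n)                        ≡⟨ ⊛-suc f (inv f) n ⟩
  f 0 * inv f (suc n) + (shiftS f ⊛ inv f) n ≡⟨ cong₂ (λ a b → a * b + (shiftS f ⊛ inv f) n) f0≡1 (inv-suc f n) ⟩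
  + 1 * - s + s                              ≡⟨ cong (_+ s) (ℤP.*-identityˡ (- s)) ⟩
  - s + s                                    ≡⟨ ℤP.+-inverseˡ s ⟩
  + 0                                        ∎
  where
  open ≡-Reasoning
  s = (shiftS f ⊛ inv f) n

AgreeBelow : ℕ → FPS → FPS → Set
AgreeBelow d f g = ∀ i → i < d → f i ≡ g i

invRev-local : ∀ n {f g} → (∀ i → i ≤ n → f i ≡ g i) → invRev f n ≡ invRev g n
invRev-local zero    _   = refl
invRev-local (suc n) {f} {g} f≡g = cong₂ _∷_ (cong -_ (sumTo-cong n nextTerm)) IH
  where
  IH = invRev-local n (λ i i≤n → f≡g i (ℕP.m≤n⇒m≤1+n i≤n))
  nextTerm : ∀ i → i ≤ n → f (suc i) * idx (invRev f n) i ≡ g (suc i) * idx (invRev g n) i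
  nextTerm i i≤n = cong₂ (λ a l → a * idx l i) (f≡g (suc i) (s≤s i≤n)) IH

inv-agreeBelow : ∀ d {f g} → AgreeBelow d f g → AgreeBelow d (inv f) (inv g)
inv-agreeBelow d f≐g n n<d =
  cong (λ l → idx l 0) (invRev-local n (λ i i≤n → f≐g i (ℕP.≤-<-trans i≤n n<d)))

Z2-⊛-agreeBelow : ∀ d {f h} → AgreeBelow d f h → AgreeBelow (2 ℕ.+ d) (Z2 ⊛ f) (Z2 ⊛ h)
Z2-⊛-agreeBelow d         f≐h zero          _               = refl
Z2-⊛-agreeBelow d         f≐h (suc zero)    _               = refl
Z2-⊛-agreeBelow d {f} {h} f≐h (suc (suc i)) (s≤s (s≤s i<d)) =
  trans (Z2-⊛-suc-suc f i) (trans (f≐h i i<d) (sym (Z2-⊛-suc-suc h i)))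

a⊛f≗g⇒f≗g⊛a⁻¹ : ∀ a a⁻¹ f g → a ⊛ a⁻¹ ≗ oneS → a ⊛ f ≗ g → f ≗ g ⊛ a⁻¹
a⊛f≗g⇒f≗g⊛a⁻¹ a a⁻¹ f g a⊛a⁻¹≗1 a⊛f≗g = begin
  f             ≈⟨ ⊛-identityʳ f ⟨
  f ⊛ oneS      ≈⟨ ⊛-cong {f} (λ _ → refl) a⊛a⁻¹≗1 ⟨
  f ⊛ (a ⊛ a⁻¹) ≈⟨ reassociate f a a⁻¹ ⟩
  (a ⊛ f) ⊛ a⁻¹ ≈⟨ ⊛-cong {g = a⁻¹} a⊛f≗g (λ _ → refl) ⟩
  g ⊛ a⁻¹       ∎
  where
  open ≗-Reasoning
  reassociate : ∀ f a b → f ⊛ (a ⊛ b) ≗ (a ⊛ f) ⊛ b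
  reassociate = solve 3 (λ f a b → f :* (a :* b) := (a :* f) :* b) (λ _ → refl)

inv-unique : ∀ f g → f 0 ≡ + 1 → f ⊛ g ≗ oneS → g ≗ inv f
inv-unique f g f0≡1 f⊛g≗1 n =
  trans (a⊛f≗g⇒f≗g⊛a⁻¹ f (inv f) g oneS (⊛-inverseʳ f f0≡1) f⊛g≗1 n) (⊛-identityˡ (inv f) n)

⊛≗0⇒≗0 : ∀ f g → g 0 ≢ + 0 → f ⊛ g ≗ zeroS → f ≗ zeroS
⊛≗0⇒≗0 f g g0≢0 fg≗0 = <-rec (λ m → f m ≡ + 0) step
  where
  open ≡-Reasoning
  step : ∀ m → (∀ {i} → i < m → f i ≡ + 0) → f m ≡ + 0
  step m lower with ℤP.i*j≡0⇒i≡0∨j≡0 (f m) (begin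
    f m * g 0       ≡⟨ cong (λ x → f m * g x) (ℕP.n∸n≡0 m) ⟨
    f m * g (m ∸ m) ≡⟨ sumTo-last m _ (λ i i<m → trans (cong (_* g (m ∸ i)) (lower i<m)) (ℤP.*-zeroˡ (g (m ∸ i)))) ⟨
    (f ⊛ g) m       ≡⟨ fg≗0 m ⟩
    + 0             ∎)
  ... | inj₁ fm≡0 = fm≡0
  ... | inj₂ g0≡0 = ⊥-elim (g0≢0 g0≡0)

[f⊖h]⊛g≗0⇒f≗h : ∀ f h g → g 0 ≢ + 0 → (f ⊖ h) ⊛ g ≗ zeroS → f ≗ h
[f⊖h]⊛g≗0⇒f≗h f h g g0≢0 eq n = ℤP.i-j≡0⇒i≡j (f n) (h n) (⊛≗0⇒≗0 (f ⊖ h) g g0≢0 eq n)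

Family : Set₁
Family = ℕ → Set

infixl 7 _⋆_
_⋆_ : Family → Family → Family
(A ⋆ B) n = Σ ℕ λ i → Σ ℕ λ j → i ℕ.+ j ≡ n × A i × B j

δ : Family
δ zero    = ⊤
δ (suc n) = ⊥

shift₂ : Family → Family
shift₂ A n = Σ ℕ λ m → 2 ℕ.+ m ≡ n × A m

-- k-Fibonacci paths and their first-return decomposition

module FirstReturn (k : ℕ) where

  Steps : Set
  Steps = List (Step k)

  Colour : Family
  Colour l = Fin (fib k l)

  record Path (n : ℕ) : Set where
    constructor path
    field
      steps   : Steps
      isValid : T (valid 0 steps)
      length  : pathLen steps ≡ n

  Path-≡ : ∀ {n} {x y : Path n} → Path.steps x ≡ Path.steps y → x ≡ y
  Path-≡ {x = path s v l} {path .s v′ l′} refl =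
    cong₂ (path s) (T-irrelevant v v′) (ℕP.≡-irrelevant l l′)

  KFibPath↔Path : ∀ n → KFibPath k n ↔ Path n
  KFibPath↔Path n = mk↔ₛ′ to from (λ { (path s v l) → Path-≡ refl }) (λ { (s , t) → cong (s ,_) (T-irrelevant _ _) })
    where
    to : KFibPath k n → Path n
    to (s , t) = let v , l = Equivalence.to T-∧ t in path s v (ℕP.≡ᵇ⇒≡ _ _ l)
    from : Path n → KFibPath k n
    from (path s v l) = s , Equivalence.from T-∧ (v , ℕP.≡⇒≡ᵇ _ _ l)

  pathLen-++-D : ∀ (p q : Steps) → pathLen (p ++ D ∷ q) ≡ suc (pathLen p ℕ.+ pathLen q)
  pathLen-++-D []      q = refl
  pathLen-++-D (s ∷ p) q = begin
    stepLen s ℕ.+ pathLen (p ++ D ∷ q)            ≡⟨ cong (stepLen s ℕ.+_) (pathLen-++-D p q) ⟩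
    stepLen s ℕ.+ suc (pathLen p ℕ.+ pathLen q)   ≡⟨ ℕP.+-suc (stepLen s) _ ⟩
    suc (stepLen s ℕ.+ (pathLen p ℕ.+ pathLen q)) ≡⟨ cong suc (ℕP.+-assoc (stepLen s) (pathLen p) (pathLen q)) ⟨
    suc (pathLen (s ∷ p) ℕ.+ pathLen q)           ∎
    where open ≡-Reasoning

  valid-++-D : ∀ d (p q : Steps) → T (valid d p) → T (valid 0 q) → T (valid (suc d) (p ++ D ∷ q))
  valid-++-D zero    []          q _  vq = vq
  valid-++-D zero    (U ∷ p)     q vp vq = valid-++-D 1 p q vp vq
  valid-++-D (suc d) (U ∷ p)     q vp vq = valid-++-D (2 ℕ.+ d) p q vp vq
  valid-++-D (suc d) (D ∷ p)     q vp vq = valid-++-D d p q vp vq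
  valid-++-D zero    (H l c ∷ p) q vp vq = valid-++-D zero p q vp vq
  valid-++-D (suc d) (H l c ∷ p) q vp vq = valid-++-D (suc d) p q vp vq

  -- A path read from height d + 1 splits at its first step down to the x-axis.
  record Return (d : ℕ) (ss : Steps) : Set where
    constructor return
    field
      before after : Steps
      splits       : ss ≡ before ++ D ∷ after
      before-valid : T (valid d before)
      after-valid  : T (valid 0 after)
  open Return

  prepend : ∀ {d e ss} s (r : Return e ss) →
            (T (valid e (before r)) → T (valid d (s ∷ before r))) → Return d (s ∷ ss)
  prepend s r lift = return (s ∷ before r) (after r) (cong (s ∷_) (splits r)) (lift (before-valid r)) (after-valid r)

  firstReturn : ∀ d ss → T (valid (suc d) ss) → Return d ss
  firstReturn zero    (D ∷ ss)     v = return [] ss refl _ v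
  firstReturn (suc d) (D ∷ ss)     v = prepend D (firstReturn d ss v) (λ x → x)
  firstReturn zero    (U ∷ ss)     v = prepend U (firstReturn 1 ss v) (λ x → x)
  firstReturn (suc d) (U ∷ ss)     v = prepend U (firstReturn (2 ℕ.+ d) ss v) (λ x → x)
  firstReturn zero    (H l c ∷ ss) v = prepend (H l c) (firstReturn zero ss v) (λ x → x)
  firstReturn (suc d) (H l c ∷ ss) v = prepend (H l c) (firstReturn (suc d) ss v) (λ x → x)

  prependEq : ∀ {b p a q : Steps} s → b ≡ p × a ≡ q → s ∷ b ≡ s ∷ p × a ≡ q
  prependEq s (b≡p , a≡q) = cong (s ∷_) b≡p , a≡q

  firstReturn-++-D : ∀ d p q → T (valid d p) → (v : T (valid (suc d) (p ++ D ∷ q))) →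
                     before (firstReturn d (p ++ D ∷ q) v) ≡ p × after (firstReturn d (p ++ D ∷ q) v) ≡ q
  firstReturn-++-D zero    []          q _  v = refl , refl
  firstReturn-++-D zero    (U ∷ p)     q vp v = prependEq U (firstReturn-++-D 1 p q vp v)
  firstReturn-++-D (suc d) (U ∷ p)     q vp v = prependEq U (firstReturn-++-D (2 ℕ.+ d) p q vp v)
  firstReturn-++-D (suc d) (D ∷ p)     q vp v = prependEq D (firstReturn-++-D d p q vp v)
  firstReturn-++-D zero    (H l c ∷ p) q vp v = prependEq (H l c) (firstReturn-++-D zero p q vp v)
  firstReturn-++-D (suc d) (H l c ∷ p) q vp v = prependEq (H l c) (firstReturn-++-D (suc d) p q vp v)

  Decomposition : Family
  Decomposition n = δ n ⊎ ((Colour ⋆ Path) n ⊎ shift₂ (Path ⋆ Path) n)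

  arch : ∀ {n} p q → T (valid 0 p) → T (valid 0 q) → 2 ℕ.+ (pathLen p ℕ.+ pathLen q) ≡ n →
         shift₂ (Path ⋆ Path) n
  arch p q vp vq e = pathLen p ℕ.+ pathLen q , e , pathLen p , pathLen q , refl , path p vp refl , path q vq refl

  arch-cong : ∀ {n p p′ q q′ vp vp′ vq vq′} {e : 2 ℕ.+ (pathLen p ℕ.+ pathLen q) ≡ n}
              {e′ : 2 ℕ.+ (pathLen p′ ℕ.+ pathLen q′) ≡ n} → p ≡ p′ → q ≡ q′ →
              arch p q vp vq e ≡ arch p′ q′ vp′ vq′ e′
  arch-cong {vp = vp} {vp′} {vq} {vq′} {e} {e′} refl refl
    rewrite T-irrelevant vp vp′ | T-irrelevant vq vq′ | ℕP.≡-irrelevant e e′ = refl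

  decompose : ∀ {n} → Path n → Decomposition n
  decompose (path []            _  refl) = inj₁ tt
  decompose (path (H l c ∷ ss) ok len)  = inj₂ (inj₁ (suc l , pathLen ss , len , c , path ss ok refl))
  decompose (path (U ∷ ss)     ok len)  = inj₂ (inj₂ (arch (before r) (after r) (before-valid r) (after-valid r) size))
    where
    r = firstReturn 0 ss ok
    size = trans (cong suc (trans (sym (pathLen-++-D (before r) (after r))) (cong pathLen (sym (splits r))))) len

  assemble : ∀ {n} → Decomposition n → Path n
  assemble (inj₂ (inj₁ (suc l , _ , e , c , path ss ok len))) = path (H l c ∷ ss) ok (trans (cong (suc l ℕ.+_) len) e)
  assemble (inj₂ (inj₂ (_ , e , _ , _ , e′ , path p vp lp , path q vq lq))) =
    path (U ∷ p ++ D ∷ q) (valid-++-D 0 p q vp vq)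
         (trans (cong suc (pathLen-++-D p q)) (trans (cong (λ m → 2 ℕ.+ m) (trans (cong₂ ℕ._+_ lp lq) e′)) e))
  assemble {zero} (inj₁ _) = path [] _ refl

  assemble-decompose : ∀ {n} (x : Path n) → assemble (decompose x) ≡ x
  assemble-decompose (path []            _  refl) = refl
  assemble-decompose (path (H l c ∷ ss) ok len)  = Path-≡ refl
  assemble-decompose (path (U ∷ ss)     ok len)  = Path-≡ (cong (U ∷_) (sym (splits (firstReturn 0 ss ok))))

  decompose-assemble : ∀ {n} (t : Decomposition n) → decompose (assemble t) ≡ t
  decompose-assemble (inj₂ (inj₁ (suc l , _ , refl , c , path ss ok refl))) = refl
  decompose-assemble (inj₂ (inj₂ (_ , refl , _ , _ , refl , path p vp refl , path q vq refl))) =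
    cong (inj₂ ∘ inj₂) (arch-cong (proj₁ unique) (proj₂ unique))
    where
    unique = firstReturn-++-D 0 p q vp (valid-++-D 0 p q vp vq)
  decompose-assemble {zero} (inj₁ _) = refl

  Path↔Decomposition : ∀ n → Path n ↔ Decomposition n
  Path↔Decomposition n = mk↔ₛ′ decompose assemble decompose-assemble assemble-decompose

convℕ : (ℕ → ℕ) → (ℕ → ℕ) → ℕ → ℕ
convℕ α β zero    = α 0 ℕ.* β 0
convℕ α β (suc n) = α 0 ℕ.* β (suc n) ℕ.+ convℕ (α ∘ suc) β n

δℕ : ℕ → ℕ
δℕ zero    = 1
δℕ (suc n) = 0

shift₂ℕ : (ℕ → ℕ) → ℕ → ℕ
shift₂ℕ γ zero          = 0
shift₂ℕ γ (suc zero)    = 0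
shift₂ℕ γ (suc (suc n)) = γ n

⋆-zero-↔ : ∀ (A B : Family) → (A ⋆ B) 0 ↔ (A 0 × B 0)
⋆-zero-↔ A B = mk↔ₛ′ (λ { (zero , zero , refl , x , y) → x , y }) (λ (x , y) → 0 , 0 , refl , x , y)
                     (λ _ → refl) (λ { (zero , zero , refl , x , y) → refl })

⋆-suc-↔ : ∀ (A B : Family) n → (A ⋆ B) (suc n) ↔ ((A 0 × B (suc n)) ⊎ ((A ∘ suc) ⋆ B) n)
⋆-suc-↔ A B n = mk↔ₛ′ to from to-from from-to
  where
  to : (A ⋆ B) (suc n) → (A 0 × B (suc n)) ⊎ ((A ∘ suc) ⋆ B) n
  to (zero  , _ , refl , x , y) = inj₁ (x , y)
  to (suc i , j , refl , x , y) = inj₂ (i , j , refl , x , y)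
  from : (A 0 × B (suc n)) ⊎ ((A ∘ suc) ⋆ B) n → (A ⋆ B) (suc n)
  from (inj₁ (x , y))             = 0 , suc n , refl , x , y
  from (inj₂ (i , j , e , x , y)) = suc i , j , cong suc e , x , y
  to-from : ∀ c → to (from c) ≡ c
  to-from (inj₁ _)                    = refl
  to-from (inj₂ (i , j , refl , x , y)) = refl
  from-to : ∀ c → from (to c) ≡ c
  from-to (zero  , _ , refl , x , y) = refl
  from-to (suc i , j , refl , x , y) = refl

⋆-↔ : ∀ α β (A B : Family) → (∀ i → Fin (α i) ↔ A i) → (∀ j → Fin (β j) ↔ B j) →
      ∀ n → Fin (convℕ α β n) ↔ (A ⋆ B) n
⋆-↔ α β A B α↔A β↔B zero = ↔-trans *↔× (↔-trans (α↔A 0 ×-↔ β↔B 0) (↔-sym (⋆-zero-↔ A B)))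
⋆-↔ α β A B α↔A β↔B (suc n) = ↔-trans (+↔⊎ {α 0 ℕ.* β (suc n)}) (↔-trans
  (↔-trans *↔× (α↔A 0 ×-↔ β↔B (suc n)) ⊎-↔ ⋆-↔ (α ∘ suc) β (A ∘ suc) B (α↔A ∘ suc) β↔B n)
  (↔-sym (⋆-suc-↔ A B n)))

δ-↔ : ∀ n → Fin (δℕ n) ↔ δ n
δ-↔ zero    = mk↔ₛ′ (λ _ → tt) (λ _ → Fin.zero) (λ _ → refl) (λ { Fin.zero → refl ; (Fin.suc ()) })
δ-↔ (suc n) = mk↔ₛ′ (λ ()) (λ ()) (λ ()) (λ ())

shift₂-↔ : ∀ γ (A : Family) → (∀ m → Fin (γ m) ↔ A m) → ∀ n → Fin (shift₂ℕ γ n) ↔ shift₂ A n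
shift₂-↔ γ A γ↔A zero          = mk↔ₛ′ (λ ()) (λ { (_ , () , _) }) (λ { (_ , () , _) }) (λ ())
shift₂-↔ γ A γ↔A (suc zero)    = mk↔ₛ′ (λ ()) (λ { (_ , () , _) }) (λ { (_ , () , _) }) (λ ())
shift₂-↔ γ A γ↔A (suc (suc n)) =
  ↔-trans (γ↔A n) (mk↔ₛ′ (λ x → n , refl , x) (λ { (_ , refl , x) → x }) (λ { (_ , refl , x) → refl }) (λ _ → refl))

pos-convℕ : ∀ (α β : ℕ → ℕ) n → + convℕ α β n ≡ ((+_ ∘ α) ⊛ (+_ ∘ β)) n
pos-convℕ α β zero    = ℤP.pos-* (α 0) (β 0)
pos-convℕ α β (suc n) = begin
  + (α 0 ℕ.* β (suc n) ℕ.+ convℕ (α ∘ suc) β n)       ≡⟨ ℤP.pos-+ (α 0 ℕ.* β (suc n)) _ ⟩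
  + (α 0 ℕ.* β (suc n)) + + convℕ (α ∘ suc) β n       ≡⟨ cong₂ _+_ (ℤP.pos-* (α 0) (β (suc n))) (pos-convℕ (α ∘ suc) β n) ⟩
  + α 0 * + β (suc n) + ((+_ ∘ α ∘ suc) ⊛ (+_ ∘ β)) n ≡⟨ ⊛-suc (+_ ∘ α) (+_ ∘ β) n ⟨
  ((+_ ∘ α) ⊛ (+_ ∘ β)) (suc n)                       ∎
  where open ≡-Reasoning

pos-δℕ : ∀ n → + δℕ n ≡ oneS n
pos-δℕ zero    = refl
pos-δℕ (suc n) = refl

pos-shift₂ℕ : ∀ γ n → + shift₂ℕ γ n ≡ (Z2 ⊛ (+_ ∘ γ)) n
pos-shift₂ℕ γ zero          = refl
pos-shift₂ℕ γ (suc zero)    = refl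
pos-shift₂ℕ γ (suc (suc n)) = sym (Z2-⊛-suc-suc (+_ ∘ γ) n)

pathCount-recurrence : ∀ k (a : ℕ → ℕ) → (∀ i → Fin (a i) ↔ KFibPath k i) →
                       ∀ n → a n ≡ δℕ n ℕ.+ (convℕ (fib k) a n ℕ.+ shift₂ℕ (convℕ a a) n)
pathCount-recurrence k a a↔KFibPath n = ↔⇒≡ (↔-trans (a↔Path n) (↔-trans (Path↔Decomposition n) (↔-sym
  (↔-trans +↔⊎ (δ-↔ n ⊎-↔ ↔-trans +↔⊎ (⋆-↔ (fib k) a Colour Path (λ _ → ↔-refl) a↔Path n
                                    ⊎-↔ shift₂-↔ (convℕ a a) (Path ⋆ Path) (⋆-↔ a a Path Path a↔Path a↔Path) n))))))
  where
  open FirstReturn k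
  a↔Path : ∀ i → Fin (a i) ↔ Path i
  a↔Path i = ↔-trans (a↔KFibPath i) (KFibPath↔Path i)

[1+k]*[1+n]C[1+k]≡[1+n]*nCk : ∀ n k → suc k ℕ.* (suc n C suc k) ≡ suc n ℕ.* (n C k)
[1+k]*[1+n]C[1+k]≡[1+n]*nCk zero    zero    = refl
[1+k]*[1+n]C[1+k]≡[1+n]*nCk zero    (suc k) = ℕP.*-zeroʳ (2 ℕ.+ k)
[1+k]*[1+n]C[1+k]≡[1+n]*nCk (suc n) zero    = trans (ℕP.*-identityˡ _) (trans (nC1≡n (2 ℕ.+ n)) (sym (ℕP.*-identityʳ _)))
[1+k]*[1+n]C[1+k]≡[1+n]*nCk (suc n) (suc k) = begin
  (2 ℕ.+ k) ℕ.* ((2 ℕ.+ n) C (2 ℕ.+ k))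
    ≡⟨ cong ((2 ℕ.+ k) ℕ.*_) (nCk+nC[k+1]≡[n+1]C[k+1] (suc n) (suc k)) ⟨
  (2 ℕ.+ k) ℕ.* (a ℕ.+ b)
    ≡⟨ split k a b ⟩
  (suc k ℕ.* a ℕ.+ a) ℕ.+ (2 ℕ.+ k) ℕ.* b
    ≡⟨ cong₂ (λ x y → (x ℕ.+ a) ℕ.+ y) ([1+k]*[1+n]C[1+k]≡[1+n]*nCk n k) ([1+k]*[1+n]C[1+k]≡[1+n]*nCk n (suc k)) ⟩
  (suc n ℕ.* (n C k) ℕ.+ a) ℕ.+ suc n ℕ.* (n C suc k)
    ≡⟨ merge n (n C k) (n C suc k) a ⟩
  suc n ℕ.* ((n C k) ℕ.+ (n C suc k)) ℕ.+ a
    ≡⟨ cong (λ x → suc n ℕ.* x ℕ.+ a) (nCk+nC[k+1]≡[n+1]C[k+1] n k) ⟩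
  suc n ℕ.* a ℕ.+ a
    ≡⟨ ℕP.+-comm (suc n ℕ.* a) a ⟩
  (2 ℕ.+ n) ℕ.* a ∎
  where
  open ≡-Reasoning
  a = suc n C suc k
  b = suc n C (2 ℕ.+ k)
  split : ∀ k a b → (2 ℕ.+ k) ℕ.* (a ℕ.+ b) ≡ (suc k ℕ.* a ℕ.+ a) ℕ.+ (2 ℕ.+ k) ℕ.* b
  split = ℕ-Solver.solve-∀
  merge : ∀ n c d a → (suc n ℕ.* c ℕ.+ a) ℕ.+ suc n ℕ.* d ≡ suc n ℕ.* (c ℕ.+ d) ℕ.+ a
  merge = ℕ-Solver.solve-∀

2[1+n]≡2+2n : ∀ n → 2 ℕ.* suc n ≡ 2 ℕ.+ 2 ℕ.* n
2[1+n]≡2+2n = ℕ-Solver.solve-∀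

[1+2n]C[1+n]≡[1+2n]Cn : ∀ n → suc (2 ℕ.* n) C suc n ≡ suc (2 ℕ.* n) C n
[1+2n]C[1+n]≡[1+2n]Cn n = trans (nCk≡nC[n∸k] (s≤s n≤2n)) (cong (suc (2 ℕ.* n) C_) 2n∸n≡n)
  where
  n≤2n : n ≤ 2 ℕ.* n
  n≤2n = ℕP.m≤n*m n 2
  2n∸n≡n : 2 ℕ.* n ∸ n ≡ n
  2n∸n≡n = trans (cong (λ m → n ℕ.+ m ∸ n) (ℕP.+-identityʳ n)) (ℕP.m+n∸n≡m n n)

[1+n]*[2n]C[1+n]≡n*[2n]Cn : ∀ n → suc n ℕ.* (2 ℕ.* n C suc n) ≡ n ℕ.* (2 ℕ.* n C n)
[1+n]*[2n]C[1+n]≡n*[2n]Cn zero    = refl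
[1+n]*[2n]C[1+n]≡n*[2n]Cn (suc n) = begin
  (2 ℕ.+ n) ℕ.* (2 ℕ.* suc n C (2 ℕ.+ n))     ≡⟨ cong (λ m → (2 ℕ.+ n) ℕ.* (m C (2 ℕ.+ n))) (2[1+n]≡2+2n n) ⟩
  (2 ℕ.+ n) ℕ.* ((2 ℕ.+ 2 ℕ.* n) C (2 ℕ.+ n)) ≡⟨ [1+k]*[1+n]C[1+k]≡[1+n]*nCk (suc (2 ℕ.* n)) (suc n) ⟩
  (2 ℕ.+ 2 ℕ.* n) ℕ.* (suc (2 ℕ.* n) C suc n) ≡⟨ cong ((2 ℕ.+ 2 ℕ.* n) ℕ.*_) ([1+2n]C[1+n]≡[1+2n]Cn n) ⟩
  (2 ℕ.+ 2 ℕ.* n) ℕ.* (suc (2 ℕ.* n) C n)     ≡⟨ [1+k]*[1+n]C[1+k]≡[1+n]*nCk (suc (2 ℕ.* n)) n ⟨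
  suc n ℕ.* ((2 ℕ.+ 2 ℕ.* n) C suc n)         ≡⟨ cong (λ m → suc n ℕ.* (m C suc n)) (2[1+n]≡2+2n n) ⟨
  suc n ℕ.* (2 ℕ.* suc n C suc n)             ∎
  where open ≡-Reasoning

[1+n]*[2+2n]C[1+n]≡[2+4n]*[2n]Cn : ∀ n → suc n ℕ.* (2 ℕ.* suc n C suc n) ≡ (2 ℕ.+ 4 ℕ.* n) ℕ.* (2 ℕ.* n C n)
[1+n]*[2+2n]C[1+n]≡[2+4n]*[2n]Cn n = ℕP.*-cancelˡ-≡ _ _ (suc n) (begin
  suc n ℕ.* (suc n ℕ.* (2 ℕ.* suc n C suc n))             ≡⟨ cong (λ m → suc n ℕ.* (suc n ℕ.* (m C suc n))) (2[1+n]≡2+2n n) ⟩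
  suc n ℕ.* (suc n ℕ.* ((2 ℕ.+ 2 ℕ.* n) C suc n))         ≡⟨ cong (suc n ℕ.*_) ([1+k]*[1+n]C[1+k]≡[1+n]*nCk (suc (2 ℕ.* n)) n) ⟩
  suc n ℕ.* ((2 ℕ.+ 2 ℕ.* n) ℕ.* (suc (2 ℕ.* n) C n))     ≡⟨ cong (λ x → suc n ℕ.* ((2 ℕ.+ 2 ℕ.* n) ℕ.* x)) ([1+2n]C[1+n]≡[1+2n]Cn n) ⟨
  suc n ℕ.* ((2 ℕ.+ 2 ℕ.* n) ℕ.* (suc (2 ℕ.* n) C suc n)) ≡⟨ swap (suc n) (2 ℕ.+ 2 ℕ.* n) (suc (2 ℕ.* n) C suc n) ⟩
  (2 ℕ.+ 2 ℕ.* n) ℕ.* (suc n ℕ.* (suc (2 ℕ.* n) C suc n)) ≡⟨ cong ((2 ℕ.+ 2 ℕ.* n) ℕ.*_) ([1+k]*[1+n]C[1+k]≡[1+n]*nCk (2 ℕ.* n) n) ⟩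
  (2 ℕ.+ 2 ℕ.* n) ℕ.* (suc (2 ℕ.* n) ℕ.* (2 ℕ.* n C n))   ≡⟨ regroup n (2 ℕ.* n C n) ⟩
  suc n ℕ.* ((2 ℕ.+ 4 ℕ.* n) ℕ.* (2 ℕ.* n C n))           ∎)
  where
  open ≡-Reasoning
  swap : ∀ a b c → a ℕ.* (b ℕ.* c) ≡ b ℕ.* (a ℕ.* c)
  swap = ℕ-Solver.solve-∀
  regroup : ∀ n x → (2 ℕ.+ 2 ℕ.* n) ℕ.* (suc (2 ℕ.* n) ℕ.* x) ≡ suc n ℕ.* ((2 ℕ.+ 4 ℕ.* n) ℕ.* x)
  regroup = ℕ-Solver.solve-∀

-- C(2n, n) - C(2n, n + 1) is an exact quotient, so the truncating division in catalan loses nothing.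
[1+n]*catalan≡[2n]Cn : ∀ n → suc n ℕ.* catalan n ≡ 2 ℕ.* n C n
[1+n]*catalan≡[2n]Cn n = begin
  suc n ℕ.* catalan n ≡⟨ cong (suc n ℕ.*_) (trans (cong (_/ suc n) (sym quotient*[1+n])) (m*n/n≡m quotient (suc n))) ⟩
  suc n ℕ.* quotient  ≡⟨ ℕP.*-comm (suc n) quotient ⟩
  quotient ℕ.* suc n  ≡⟨ quotient*[1+n] ⟩
  2 ℕ.* n C n         ∎
  where
  open ≡-Reasoning
  quotient : ℕ
  quotient = (2 ℕ.* n C n) ∸ (2 ℕ.* n C suc n)
  quotient*[1+n] : quotient ℕ.* suc n ≡ 2 ℕ.* n C n
  quotient*[1+n] = begin
    quotient ℕ.* suc n                                          ≡⟨ ℕP.*-comm quotient (suc n) ⟩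
    suc n ℕ.* quotient                                          ≡⟨ ℕP.*-distribˡ-∸ (suc n) (2 ℕ.* n C n) (2 ℕ.* n C suc n) ⟩
    suc n ℕ.* (2 ℕ.* n C n) ∸ suc n ℕ.* (2 ℕ.* n C suc n)       ≡⟨ cong (suc n ℕ.* (2 ℕ.* n C n) ∸_) ([1+n]*[2n]C[1+n]≡n*[2n]Cn n) ⟩
    (2 ℕ.* n C n) ℕ.+ n ℕ.* (2 ℕ.* n C n) ∸ n ℕ.* (2 ℕ.* n C n) ≡⟨ ℕP.m+n∸n≡m (2 ℕ.* n C n) (n ℕ.* (2 ℕ.* n C n)) ⟩
    2 ℕ.* n C n                                                 ∎

catalan-recurrence : ∀ n → (2 ℕ.+ n) ℕ.* catalan (suc n) ≡ (2 ℕ.+ 4 ℕ.* n) ℕ.* catalan n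
catalan-recurrence n = ℕP.*-cancelˡ-≡ _ _ (suc n) (begin
  suc n ℕ.* ((2 ℕ.+ n) ℕ.* catalan (suc n)) ≡⟨ cong (suc n ℕ.*_) ([1+n]*catalan≡[2n]Cn (suc n)) ⟩
  suc n ℕ.* (2 ℕ.* suc n C suc n)           ≡⟨ [1+n]*[2+2n]C[1+n]≡[2+4n]*[2n]Cn n ⟩
  (2 ℕ.+ 4 ℕ.* n) ℕ.* (2 ℕ.* n C n)         ≡⟨ cong ((2 ℕ.+ 4 ℕ.* n) ℕ.*_) ([1+n]*catalan≡[2n]Cn n) ⟨
  (2 ℕ.+ 4 ℕ.* n) ℕ.* (suc n ℕ.* catalan n) ≡⟨ swap (2 ℕ.+ 4 ℕ.* n) (suc n) (catalan n) ⟩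
  suc n ℕ.* ((2 ℕ.+ 4 ℕ.* n) ℕ.* catalan n) ∎)
  where
  open ≡-Reasoning
  swap : ∀ a b c → a ℕ.* (b ℕ.* c) ≡ b ℕ.* (a ℕ.* c)
  swap = ℕ-Solver.solve-∀

-- The Catalan generating function

θ : FPS → FPS
θ f n = + n * f n

θ-⊛ : ∀ f g → θ (f ⊛ g) ≗ θ f ⊛ g ⊕ f ⊛ θ g
θ-⊛ f g n = begin
  + n * sumTo n (λ i → f i * g (n ∸ i))                                 ≡⟨ sumTo-*ˡ n (+ n) _ ⟨
  sumTo n (λ i → + n * (f i * g (n ∸ i)))                               ≡⟨ sumTo-cong n leibniz ⟩
  sumTo n (λ i → + i * f i * g (n ∸ i) + f i * (+ (n ∸ i) * g (n ∸ i))) ≡⟨ sumTo-+ n _ _ ⟩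
  (θ f ⊛ g ⊕ f ⊛ θ g) n                                                 ∎
  where
  open ≡-Reasoning
  split : ∀ a b x y → (a + b) * (x * y) ≡ a * x * y + x * (b * y)
  split = solve-∀
  leibniz : ∀ i → i ≤ n → + n * (f i * g (n ∸ i)) ≡ + i * f i * g (n ∸ i) + f i * (+ (n ∸ i) * g (n ∸ i))
  leibniz i i≤n = trans (cong (λ m → + m * (f i * g (n ∸ i))) (sym (ℕP.m+[n∸m]≡n i≤n)))
                        (trans (cong (_* (f i * g (n ∸ i))) (ℤP.pos-+ i (n ∸ i))) (split (+ i) (+ (n ∸ i)) (f i) (g (n ∸ i))))

θ-⊕ : ∀ f g → θ (f ⊕ g) ≗ θ f ⊕ θ g
θ-⊕ f g n = ℤP.*-distribˡ-+ (+ n) (f n) (g n)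

θ-⊖ : ∀ f g → θ (f ⊖ g) ≗ θ f ⊖ θ g
θ-⊖ f g n = trans (ℤP.*-distribˡ-+ (+ n) (f n) (- g n)) (cong (λ x → + n * f n + x) (sym (ℤP.neg-distribʳ-* (+ n) (g n))))

θ-X : θ X ≗ X
θ-X zero          = refl
θ-X (suc zero)    = refl
θ-X (suc (suc n)) = ℤP.*-zeroʳ (+ suc (suc n))

θ-oneS : θ oneS ≗ zeroS
θ-oneS zero    = refl
θ-oneS (suc n) = ℤP.*-zeroʳ (+ suc n)

catalanS : FPS
catalanS n = + catalan n

1-4X : FPS
1-4X = oneS ⊖ constS (+ 4) ⊛ X

1-4X-⊛-suc : ∀ g m → (1-4X ⊛ g) (suc m) ≡ g (suc m) - + 4 * g m
1-4X-⊛-suc g m = begin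
  (1-4X ⊛ g) (suc m)                           ≡⟨ expand X g (suc m) ⟩
  g (suc m) - (constS (+ 4) ⊛ (X ⊛ g)) (suc m) ≡⟨ cong (λ x → g (suc m) - x) (constS-⊛ (+ 4) (X ⊛ g) (suc m)) ⟩
  g (suc m) - + 4 * (X ⊛ g) (suc m)            ≡⟨ cong (λ x → g (suc m) - + 4 * x) (X-⊛-suc g m) ⟩
  g (suc m) - + 4 * g m                        ∎
  where
  open ≡-Reasoning
  expand : ∀ x g → (oneS ⊖ constS (+ 4) ⊛ x) ⊛ g ≗ g ⊖ constS (+ 4) ⊛ (x ⊛ g)
  expand = solve 2 (λ x g → (con (+ 1) :- con (+ 4) :* x) :* g := g :- con (+ 4) :* (x :* g)) (λ _ → refl)

-- The Catalan recurrence, read as a differential equation for θ = z d/dz.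
1-4X⊛θcatalanS : 1-4X ⊛ θ catalanS ≗ oneS ⊖ catalanS ⊕ constS (+ 2) ⊛ (X ⊛ catalanS)
1-4X⊛θcatalanS zero    = refl
1-4X⊛θcatalanS (suc m) = begin
  (1-4X ⊛ θ catalanS) (suc m)
    ≡⟨ 1-4X-⊛-suc (θ catalanS) m ⟩
  + suc m * c₁ - + 4 * (+ m * c₀)
    ≡⟨ rearrange (+ m) c₀ c₁ ⟩
  ((+ 2 + + m) * c₁ - (+ 2 + + 4 * + m) * c₀) + (+ 0 - c₁ + + 2 * c₀)
    ≡⟨ cong (λ x → x + (+ 0 - c₁ + + 2 * c₀)) recurrence≡0 ⟩
  + 0 + (+ 0 - c₁ + + 2 * c₀)
    ≡⟨ ℤP.+-identityˡ _ ⟩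
  + 0 - c₁ + + 2 * c₀
    ≡⟨ cong (λ x → + 0 - c₁ + x) (trans (constS-⊛ (+ 2) (X ⊛ catalanS) (suc m)) (cong (+ 2 *_) (X-⊛-suc catalanS m))) ⟨
  (oneS ⊖ catalanS ⊕ constS (+ 2) ⊛ (X ⊛ catalanS)) (suc m) ∎
  where
  open ≡-Reasoning
  c₀ = catalanS m
  c₁ = catalanS (suc m)
  rearrange : ∀ a k₀ k₁ → (+ 1 + a) * k₁ - + 4 * (a * k₀) ≡ ((+ 2 + a) * k₁ - (+ 2 + + 4 * a) * k₀) + (+ 0 - k₁ + + 2 * k₀)
  rearrange = solve-∀
  recurrence≡0 : (+ 2 + + m) * c₁ - (+ 2 + + 4 * + m) * c₀ ≡ + 0
  recurrence≡0 = ℤP.i≡j⇒i-j≡0 (begin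
    (+ 2 + + m) * c₁                  ≡⟨ ℤP.pos-* (2 ℕ.+ m) (catalan (suc m)) ⟨
    + ((2 ℕ.+ m) ℕ.* catalan (suc m)) ≡⟨ cong +_ (catalan-recurrence m) ⟩
    + ((2 ℕ.+ 4 ℕ.* m) ℕ.* catalan m) ≡⟨ ℤP.pos-* (2 ℕ.+ 4 ℕ.* m) (catalan m) ⟩
    + (2 ℕ.+ 4 ℕ.* m) * c₀            ≡⟨ cong (_* c₀) (trans (ℤP.pos-+ 2 (4 ℕ.* m)) (cong (λ x → + 2 + x) (ℤP.pos-* 4 m))) ⟩
    (+ 2 + + 4 * + m) * c₀            ∎)

catalanDefect : FPS
catalanDefect = X ⊛ (catalanS ⊛ catalanS) ⊖ catalanS ⊕ oneS

θ-catalanDefect : θ catalanDefect ≗ X ⊛ (catalanS ⊛ catalanS) ⊕ X ⊛ (θ catalanS ⊛ catalanS ⊕ catalanS ⊛ θ catalanS) ⊖ θ catalanS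
θ-catalanDefect = begin
  θ (X ⊛ K² ⊖ K ⊕ oneS)
    ≈⟨ θ-⊕ (X ⊛ K² ⊖ K) oneS ⟩
  θ (X ⊛ K² ⊖ K) ⊕ θ oneS
    ≈⟨ ⊕-cong (θ-⊖ (X ⊛ K²) K) θ-oneS ⟩
  θ (X ⊛ K²) ⊖ θ K ⊕ zeroS
    ≈⟨ (λ n → ℤP.+-identityʳ _) ⟩
  θ (X ⊛ K²) ⊖ θ K
    ≈⟨ ⊖-cong {g = θ K} (θ-⊛ X K²) (λ _ → refl) ⟩
  θ X ⊛ K² ⊕ X ⊛ θ K² ⊖ θ K
    ≈⟨ ⊖-cong {g = θ K} (⊕-cong (⊛-cong {g = K²} θ-X (λ _ → refl)) (⊛-cong {X} (λ _ → refl) (θ-⊛ K K))) (λ _ → refl) ⟩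
  X ⊛ K² ⊕ X ⊛ (θ K ⊛ K ⊕ K ⊛ θ K) ⊖ θ K ∎
  where
  open ≗-Reasoning
  K = catalanS
  K² = K ⊛ K

1-4X⊛θcatalanDefect : 1-4X ⊛ θ catalanDefect ≗ negS catalanDefect
1-4X⊛θcatalanDefect = begin
  1-4X ⊛ θ catalanDefect
    ≈⟨ ⊛-cong {1-4X} (λ _ → refl) θ-catalanDefect ⟩
  1-4X ⊛ (X ⊛ (K ⊛ K) ⊕ X ⊛ (θ K ⊛ K ⊕ K ⊛ θ K) ⊖ θ K)
    ≈⟨ factor X K (θ K) ⟩
  1-4X ⊛ X ⊛ (K ⊛ K) ⊕ (two ⊛ X ⊛ K ⊖ oneS) ⊛ (1-4X ⊛ θ K)
    ≈⟨ ⊕-cong {1-4X ⊛ X ⊛ (K ⊛ K)} (λ _ → refl) (⊛-cong {two ⊛ X ⊛ K ⊖ oneS} (λ _ → refl) 1-4X⊛θcatalanS) ⟩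
  1-4X ⊛ X ⊛ (K ⊛ K) ⊕ (two ⊛ X ⊛ K ⊖ oneS) ⊛ (oneS ⊖ K ⊕ two ⊛ (X ⊛ K))
    ≈⟨ collapse X K ⟩
  negS catalanDefect ∎
  where
  open ≗-Reasoning
  K = catalanS
  two = constS (+ 2)
  factor : ∀ x k e → (oneS ⊖ constS (+ 4) ⊛ x) ⊛ (x ⊛ (k ⊛ k) ⊕ x ⊛ (e ⊛ k ⊕ k ⊛ e) ⊖ e)
                   ≗ (oneS ⊖ constS (+ 4) ⊛ x) ⊛ x ⊛ (k ⊛ k) ⊕ (two ⊛ x ⊛ k ⊖ oneS) ⊛ ((oneS ⊖ constS (+ 4) ⊛ x) ⊛ e)
  factor = solve 3 (λ x k e → (con (+ 1) :- con (+ 4) :* x) :* (x :* (k :* k) :+ x :* (e :* k :+ k :* e) :- e)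
                   := (con (+ 1) :- con (+ 4) :* x) :* x :* (k :* k) :+ (con (+ 2) :* x :* k :- con (+ 1)) :* ((con (+ 1) :- con (+ 4) :* x) :* e))
                   (λ _ → refl)
  collapse : ∀ x k → (oneS ⊖ constS (+ 4) ⊛ x) ⊛ x ⊛ (k ⊛ k) ⊕ (two ⊛ x ⊛ k ⊖ oneS) ⊛ (oneS ⊖ k ⊕ two ⊛ (x ⊛ k))
                   ≗ negS (x ⊛ (k ⊛ k) ⊖ k ⊕ oneS)
  collapse = solve 2 (λ x k → (con (+ 1) :- con (+ 4) :* x) :* x :* (k :* k) :+ (con (+ 2) :* x :* k :- con (+ 1)) :* (con (+ 1) :- k :+ con (+ 2) :* (x :* k))
                   := :- (x :* (k :* k) :- k :+ con (+ 1)))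
                   (λ _ → refl)

catalanDefect-recurrence : ∀ m → (+ 2 + + m) * catalanDefect (suc m) ≡ + 4 * (+ m * catalanDefect m)
catalanDefect-recurrence m = begin
  (+ 2 + + m) * Q (suc m)                       ≡⟨ rearrange (+ m) (Q (suc m)) r ⟩
  ((+ 1 + + m) * Q (suc m) - r) + Q (suc m) + r ≡⟨ cong (λ x → x + Q (suc m) + r) θ-coefficient ⟩
  - Q (suc m) + Q (suc m) + r                   ≡⟨ cong (_+ r) (ℤP.+-inverseˡ (Q (suc m))) ⟩
  + 0 + r                                       ≡⟨ ℤP.+-identityˡ r ⟩
  r                                             ∎
  where
  open ≡-Reasoning
  Q = catalanDefect
  r = + 4 * (+ m * Q m)
  θ-coefficient : (+ 1 + + m) * Q (suc m) - r ≡ - Q (suc m)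
  θ-coefficient = trans (sym (1-4X-⊛-suc (θ Q) m)) (1-4X⊛θcatalanDefect (suc m))
  rearrange : ∀ a q r → (+ 2 + a) * q ≡ ((+ 1 + a) * q - r) + q + r
  rearrange = solve-∀

catalanDefect≗0 : catalanDefect ≗ zeroS
catalanDefect≗0 zero    = refl
catalanDefect≗0 (suc m) = ℤP.*-cancelˡ-≡ (+ (2 ℕ.+ m)) _ (+ 0) (begin
  (+ 2 + + m) * catalanDefect (suc m) ≡⟨ catalanDefect-recurrence m ⟩
  + 4 * (+ m * catalanDefect m)       ≡⟨ cong (λ x → + 4 * (+ m * x)) (catalanDefect≗0 m) ⟩
  + 4 * (+ m * + 0)                   ≡⟨ cong (+ 4 *_) (ℤP.*-zeroʳ (+ m)) ⟩
  + 0                                 ≡⟨ ℤP.*-zeroʳ (+ (2 ℕ.+ m)) ⟨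
  + (2 ℕ.+ m) * + 0                   ∎)
  where open ≡-Reasoning

catalanS-equation : catalanS ≗ oneS ⊕ X ⊛ (catalanS ⊛ catalanS)
catalanS-equation = begin
  K                                    ≈⟨ regroup X K ⟩
  (oneS ⊕ X ⊛ (K ⊛ K)) ⊖ catalanDefect ≈⟨ ⊖-cong {oneS ⊕ X ⊛ (K ⊛ K)} (λ _ → refl) catalanDefect≗0 ⟩
  (oneS ⊕ X ⊛ (K ⊛ K)) ⊖ zeroS         ≈⟨ (λ n → ℤP.+-identityʳ _) ⟩
  oneS ⊕ X ⊛ (K ⊛ K)                   ∎
  where
  open ≗-Reasoning
  K = catalanS
  regroup : ∀ x k → k ≗ (oneS ⊕ x ⊛ (k ⊛ k)) ⊖ (x ⊛ (k ⊛ k) ⊖ k ⊕ oneS)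
  regroup = solve 2 (λ x k → k := (con (+ 1) :+ x :* (k :* k)) :- (x :* (k :* k) :- k :+ con (+ 1))) (λ _ → refl)

-- Substitution into a series without constant term

constS⊕X⊛shiftS : ∀ G → G ≗ constS (G 0) ⊕ X ⊛ shiftS G
constS⊕X⊛shiftS G zero    = sym (ℤP.+-identityʳ (G 0))
constS⊕X⊛shiftS G (suc n) = sym (trans (ℤP.+-identityˡ _) (X-⊛-suc (shiftS G) n))

⊛-constS⊕ : ∀ f c x h → f ⊛ (constS c ⊕ x ⊛ h) ≗ c • f ⊕ x ⊛ (f ⊛ h)
⊛-constS⊕ f c x h = begin
  f ⊛ (constS c ⊕ x ⊛ h)     ≈⟨ distribute f x h (constS c) ⟩
  constS c ⊛ f ⊕ x ⊛ (f ⊛ h) ≈⟨ ⊕-cong {g = x ⊛ (f ⊛ h)} (constS-⊛ c f) (λ _ → refl) ⟩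
  c • f ⊕ x ⊛ (f ⊛ h)        ∎
  where
  open ≗-Reasoning
  distribute : ∀ f x h c → f ⊛ (c ⊕ x ⊛ h) ≗ c ⊛ f ⊕ x ⊛ (f ⊛ h)
  distribute = solve 4 (λ f x h c → f :* (c :+ x :* h) := c :* f :+ x :* (f :* h)) (λ _ → refl)

module Substitution (y : FPS) (y0≡0 : y 0 ≡ + 0) where

  substitute : FPS → FPS
  substitute F t = sumTo t (λ n → F n * powS y n t)

  y⊛-local : ∀ t {h h′} → (∀ i → i < t → h i ≡ h′ i) → (y ⊛ h) t ≡ (y ⊛ h′) t
  y⊛-local t {h} {h′} h≐h′ = sumTo-cong t agree
    where
    agree : ∀ i → i ≤ t → y i * h (t ∸ i) ≡ y i * h′ (t ∸ i)
    agree zero    _   = trans (cong (_* h t) y0≡0) (sym (cong (_* h′ t) y0≡0))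
    agree (suc i) i<t = cong (y (suc i) *_) (h≐h′ (t ∸ suc i) (ℕP.∸-monoʳ-< (s≤s z≤n) i<t))

  powS-low : ∀ m s → s < m → powS y m s ≡ + 0
  powS-low (suc m) s s<m = sumTo-zero s _ vanish
    where
    vanish : ∀ i → i ≤ s → y i * powS y m (s ∸ i) ≡ + 0
    vanish zero    _   = trans (cong (_* powS y m s) y0≡0) (ℤP.*-zeroˡ (powS y m s))
    vanish (suc i) i≤s = trans (cong (y (suc i) *_) (powS-low m (s ∸ suc i) s∸i<m)) (ℤP.*-zeroʳ (y (suc i)))
      where
      s∸i<m : s ∸ suc i < m
      s∸i<m = ℕP.<-≤-trans (ℕP.∸-monoʳ-< (s≤s z≤n) i≤s) (ℕP.≤-pred s<m)

  substitute-extend : ∀ F t N → t ≤ N → sumTo N (λ n → F n * powS y n t) ≡ substitute F t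
  substitute-extend F t N t≤N =
    sumTo-extend t N _ t≤N (λ i t<i → trans (cong (F i *_) (powS-low i t t<i)) (ℤP.*-zeroʳ (F i)))

  substitute-cong : ∀ {F G} → F ≗ G → substitute F ≗ substitute G
  substitute-cong F≗G t = sumTo-ext t (λ n → cong (_* powS y n t) (F≗G n))

  substitute-⊕ : ∀ F G → substitute (F ⊕ G) ≗ substitute F ⊕ substitute G
  substitute-⊕ F G t = trans (sumTo-ext t (λ n → ℤP.*-distribʳ-+ (powS y n t) (F n) (G n))) (sumTo-+ t _ _)

  substitute-⊖ : ∀ F G → substitute (F ⊖ G) ≗ substitute F ⊖ substitute G
  substitute-⊖ F G t = trans (substitute-⊕ F (negS G) t) (cong (λ x → substitute F t + x) negate)
    where
    negate : substitute (negS G) t ≡ - substitute G t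
    negate = trans (sumTo-ext t (λ n → sym (ℤP.neg-distribˡ-* (G n) (powS y n t)))) (sumTo-neg t _)

  substitute-• : ∀ c F → substitute (c • F) ≗ c • substitute F
  substitute-• c F t = trans (sumTo-ext t (λ n → ℤP.*-assoc c (F n) (powS y n t))) (sumTo-*ˡ t c _)

  substitute-constS : ∀ c → substitute (constS c) ≗ constS c
  substitute-constS c t = trans (sumTo-first t _ higher) (constant t)
    where
    higher : ∀ i → 0 < i → constS c i * powS y i t ≡ + 0
    higher (suc i) _ = ℤP.*-zeroˡ (powS y (suc i) t)
    constant : ∀ t → c * oneS t ≡ constS c t
    constant zero    = ℤP.*-identityʳ c
    constant (suc t) = ℤP.*-zeroʳ c

  substitute-X⊛ : ∀ F → substitute (X ⊛ F) ≗ y ⊛ substitute F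
  substitute-X⊛ F zero    = sym (trans (cong (_* substitute F 0) y0≡0) (ℤP.*-zeroˡ (substitute F 0)))
  substitute-X⊛ F (suc s) = begin
    substitute (X ⊛ F) (suc s)
      ≡⟨ sumTo-head s _ ⟩
    + 0 * powS y 0 (suc s) + sumTo s (λ n → (X ⊛ F) (suc n) * powS y (suc n) (suc s))
      ≡⟨ ℤP.+-identityˡ _ ⟩
    sumTo s (λ n → (X ⊛ F) (suc n) * (y ⊛ powS y n) (suc s))
      ≡⟨ sumTo-ext s (λ n → cong (_* (y ⊛ powS y n) (suc s)) (X-⊛-suc F n)) ⟩
    sumTo s (λ n → F n * (y ⊛ powS y n) (suc s))
      ≡⟨ sumTo-extend s (suc s) _ (ℕP.n≤1+n s) lastTerm ⟨
    sumTo (suc s) (λ n → F n * sumTo (suc s) (λ i → y i * powS y n (suc s ∸ i)))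
      ≡⟨ sumTo-ext (suc s) (λ n → sym (sumTo-*ˡ (suc s) (F n) _)) ⟩
    sumTo (suc s) (λ n → sumTo (suc s) (λ i → F n * (y i * powS y n (suc s ∸ i))))
      ≡⟨ sumTo-ext (suc s) (λ n → sumTo-ext (suc s) (λ i → swap (F n) (y i) _)) ⟩
    sumTo (suc s) (λ n → sumTo (suc s) (λ i → y i * (F n * powS y n (suc s ∸ i))))
      ≡⟨ sumTo-swap (suc s) (suc s) _ ⟩
    sumTo (suc s) (λ i → sumTo (suc s) (λ n → y i * (F n * powS y n (suc s ∸ i))))
      ≡⟨ sumTo-ext (suc s) (λ i → sumTo-*ˡ (suc s) (y i) _) ⟩
    sumTo (suc s) (λ i → y i * sumTo (suc s) (λ n → F n * powS y n (suc s ∸ i)))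
      ≡⟨ sumTo-ext (suc s) (λ i → cong (y i *_) (substitute-extend F (suc s ∸ i) (suc s) (ℕP.m∸n≤m (suc s) i))) ⟩
    (y ⊛ substitute F) (suc s) ∎
    where
    open ≡-Reasoning
    swap : ∀ a b c → a * (b * c) ≡ b * (a * c)
    swap = solve-∀
    lastTerm : ∀ i → s < i → F i * (y ⊛ powS y i) (suc s) ≡ + 0
    lastTerm i s<i = trans (cong (F i *_) (powS-low (suc i) (suc s) (s≤s s<i))) (ℤP.*-zeroʳ (F i))

  substitute-shift : ∀ G → substitute G ≗ constS (G 0) ⊕ y ⊛ substitute (shiftS G)
  substitute-shift G = begin
    substitute G                                          ≈⟨ substitute-cong (constS⊕X⊛shiftS G) ⟩
    substitute (constS (G 0) ⊕ X ⊛ shiftS G)              ≈⟨ substitute-⊕ (constS (G 0)) (X ⊛ shiftS G) ⟩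
    substitute (constS (G 0)) ⊕ substitute (X ⊛ shiftS G) ≈⟨ ⊕-cong (substitute-constS (G 0)) (substitute-X⊛ (shiftS G)) ⟩
    constS (G 0) ⊕ y ⊛ substitute (shiftS G)              ∎
    where open ≗-Reasoning

  -- Strong induction on the coefficient index, for all F and G at once; y⊛-local applies
  -- because y has no constant term.
  substitute-⊛ : ∀ F G → substitute (F ⊛ G) ≗ substitute F ⊛ substitute G
  substitute-⊛ F G t = <-rec (λ t → ∀ F G → substitute (F ⊛ G) t ≡ (substitute F ⊛ substitute G) t) step t F G
    where
    step : ∀ t → (∀ {i} → i < t → ∀ F G → substitute (F ⊛ G) i ≡ (substitute F ⊛ substitute G) i) →
           ∀ F G → substitute (F ⊛ G) t ≡ (substitute F ⊛ substitute G) t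
    step t IH F G = begin
      substitute (F ⊛ G) t
        ≡⟨ substitute-cong (⊛-cong {F} (λ _ → refl) (constS⊕X⊛shiftS G)) t ⟩
      substitute (F ⊛ (constS (G 0) ⊕ X ⊛ shiftS G)) t
        ≡⟨ substitute-cong (⊛-constS⊕ F (G 0) X (shiftS G)) t ⟩
      substitute (G 0 • F ⊕ X ⊛ (F ⊛ shiftS G)) t
        ≡⟨ substitute-⊕ (G 0 • F) (X ⊛ (F ⊛ shiftS G)) t ⟩
      substitute (G 0 • F) t + substitute (X ⊛ (F ⊛ shiftS G)) t
        ≡⟨ cong₂ _+_ (substitute-• (G 0) F t) (substitute-X⊛ (F ⊛ shiftS G) t) ⟩
      G 0 * substitute F t + (y ⊛ substitute (F ⊛ shiftS G)) t
        ≡⟨ cong (λ x → G 0 * substitute F t + x) (y⊛-local t (λ i i<t → IH i<t F (shiftS G))) ⟩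
      G 0 * substitute F t + (y ⊛ (substitute F ⊛ substitute (shiftS G))) t
        ≡⟨ ⊛-constS⊕ (substitute F) (G 0) y (substitute (shiftS G)) t ⟨
      (substitute F ⊛ (constS (G 0) ⊕ y ⊛ substitute (shiftS G))) t
        ≡⟨ ⊛-cong {substitute F} (λ _ → refl) (substitute-shift G) t ⟨
      (substitute F ⊛ substitute G) t ∎
      where open ≡-Reasoning

  ⊛-substitute : ∀ g F t → (g ⊛ substitute F) t ≡ sumTo t (λ n → F n * (g ⊛ powS y n) t)
  ⊛-substitute g F t = begin
    sumTo t (λ i → g i * substitute F (t ∸ i))
      ≡⟨ sumTo-ext t (λ i → cong (g i *_) (substitute-extend F (t ∸ i) t (ℕP.m∸n≤m t i))) ⟨
    sumTo t (λ i → g i * sumTo t (λ n → F n * powS y n (t ∸ i)))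
      ≡⟨ sumTo-ext t (λ i → sumTo-*ˡ t (g i) _) ⟨
    sumTo t (λ i → sumTo t (λ n → g i * (F n * powS y n (t ∸ i))))
      ≡⟨ sumTo-swap t t _ ⟩
    sumTo t (λ n → sumTo t (λ i → g i * (F n * powS y n (t ∸ i))))
      ≡⟨ sumTo-ext t (λ n → sumTo-ext t (λ i → swap (g i) (F n) (powS y n (t ∸ i)))) ⟩
    sumTo t (λ n → sumTo t (λ i → F n * (g i * powS y n (t ∸ i))))
      ≡⟨ sumTo-ext t (λ n → sumTo-*ˡ t (F n) _) ⟩
    sumTo t (λ n → F n * (g ⊛ powS y n) t) ∎
    where
    open ≡-Reasoning
    swap : ∀ a b c → a * (b * c) ≡ b * (a * c)
    swap = solve-∀

powS-⊛ : ∀ f g m → powS (f ⊛ g) m ≗ powS f m ⊛ powS g m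
powS-⊛ f g zero    = λ n → sym (⊛-identityˡ oneS n)
powS-⊛ f g (suc m) = begin
  (f ⊛ g) ⊛ powS (f ⊛ g) m        ≈⟨ ⊛-cong {f ⊛ g} (λ _ → refl) (powS-⊛ f g m) ⟩
  (f ⊛ g) ⊛ (powS f m ⊛ powS g m) ≈⟨ interchange f g (powS f m) (powS g m) ⟩
  (f ⊛ powS f m) ⊛ (g ⊛ powS g m) ∎
  where
  open ≗-Reasoning
  interchange : ∀ f g p q → (f ⊛ g) ⊛ (p ⊛ q) ≗ (f ⊛ p) ⊛ (g ⊛ q)
  interchange = solve 4 (λ f g p q → (f :* g) :* (p :* q) := (f :* p) :* (g :* q)) (λ _ → refl)

powS-X-⊛-+ : ∀ j h s → (powS X j ⊛ h) (j ℕ.+ s) ≡ h s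
powS-X-⊛-+ zero    h s = ⊛-identityˡ h s
powS-X-⊛-+ (suc j) h s =
  trans (⊛-assoc X (powS X j) h (suc (j ℕ.+ s))) (trans (X-⊛-suc (powS X j ⊛ h) (j ℕ.+ s)) (powS-X-⊛-+ j h s))

powS-X-⊛-low : ∀ j h s → s < j → (powS X j ⊛ h) s ≡ + 0
powS-X-⊛-low (suc j) h zero    _         = ⊛-assoc X (powS X j) h 0
powS-X-⊛-low (suc j) h (suc s) (s≤s s<j) =
  trans (⊛-assoc X (powS X j) h (suc s)) (trans (X-⊛-suc (powS X j ⊛ h) s) (powS-X-⊛-low j h s s<j))

powS-X-⊛ : ∀ j h t → j ≤ t → (powS X j ⊛ h) t ≡ h (t ∸ j)
powS-X-⊛ j h t j≤t = trans (cong (powS X j ⊛ h) (sym (ℕP.m+[n∸m]≡n j≤t))) (powS-X-⊛-+ j h (t ∸ j))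

-- The binomial series (1 - z)^-(r+1)

geometricS : FPS
geometricS _ = + 1

binomialS : ℕ → FPS
binomialS r m = + ((m ℕ.+ r) C m)

1-X-⊛ : ∀ g → (oneS ⊖ X) ⊛ g ≗ g ⊖ X ⊛ g
1-X-⊛ g = expand X g
  where
  expand : ∀ x g → (oneS ⊖ x) ⊛ g ≗ g ⊖ x ⊛ g
  expand = solve 2 (λ x g → (con (+ 1) :- x) :* g := g :- x :* g) (λ _ → refl)

1-X⊛geometricS : (oneS ⊖ X) ⊛ geometricS ≗ oneS
1-X⊛geometricS zero    = refl
1-X⊛geometricS (suc m) = trans (1-X-⊛ geometricS (suc m)) (cong (λ x → + 1 - x) (X-⊛-suc geometricS m))

1-X⊛binomialS : ∀ r → (oneS ⊖ X) ⊛ binomialS (suc r) ≗ binomialS r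
1-X⊛binomialS r zero    = refl
1-X⊛binomialS r (suc m) = begin
  ((oneS ⊖ X) ⊛ binomialS (suc r)) (suc m)   ≡⟨ 1-X-⊛ (binomialS (suc r)) (suc m) ⟩
  + ((suc m ℕ.+ suc r) C suc m) - (X ⊛ binomialS (suc r)) (suc m)
                                             ≡⟨ cong (λ x → + ((suc m ℕ.+ suc r) C suc m) - x) (X-⊛-suc (binomialS (suc r)) m) ⟩
  + (suc n C suc m) - + (n C m)           ≡⟨ cong (λ x → + x - + (n C m)) (nCk+nC[k+1]≡[n+1]C[k+1] n m) ⟨
  + ((n C m) ℕ.+ (n C suc m)) - + (n C m) ≡⟨ cong (_- + (n C m)) (ℤP.pos-+ (n C m) (n C suc m)) ⟩
  + (n C m) + + (n C suc m) - + (n C m)   ≡⟨ cancel (+ (n C m)) (+ (n C suc m)) ⟩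
  + (n C suc m)                           ≡⟨ cong (λ x → + (x C suc m)) (ℕP.+-suc m r) ⟩
  binomialS r (suc m)                     ∎
  where
  open ≡-Reasoning
  n = m ℕ.+ suc r
  cancel : ∀ a b → a + b - a ≡ b
  cancel = solve-∀

binomialS-zero : binomialS 0 ≗ geometricS
binomialS-zero m = cong +_ (trans (cong (_C m) (ℕP.+-identityʳ m)) (nCn≡1 m))

binomialS-suc : ∀ r → binomialS (suc r) ≗ binomialS r ⊛ geometricS
binomialS-suc r = a⊛f≗g⇒f≗g⊛a⁻¹ (oneS ⊖ X) geometricS _ _ 1-X⊛geometricS (1-X⊛binomialS r)

quadratic-⊛-suc-suc : ∀ a b c f n →
  (poly (a ∷ b ∷ c ∷ []) ⊛ f) (suc (suc n)) ≡ a * f (suc (suc n)) + (b * f (suc n) + c * f n)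
quadratic-⊛-suc-suc a b c f n = begin
  (p ⊛ f) (suc (suc n))                                                 ≡⟨ sumTo-head (suc n) _ ⟩
  a * f (suc (suc n)) + sumTo (suc n) (λ i → p (suc i) * f (suc n ∸ i)) ≡⟨ cong (λ x → a * f (suc (suc n)) + x) (sumTo-head n _) ⟩
  a * f (suc (suc n)) + (b * f (suc n) + sumTo n (λ i → p (2 ℕ.+ i) * f (n ∸ i)))
                                                                      ≡⟨ cong (λ x → a * f (suc (suc n)) + (b * f (suc n) + x)) (sumTo-first n _ higher) ⟩
  a * f (suc (suc n)) + (b * f (suc n) + c * f n)                     ∎
  where
  open ≡-Reasoning
  p = poly (a ∷ b ∷ c ∷ [])
  higher : ∀ i → 0 < i → p (2 ℕ.+ i) * f (n ∸ i) ≡ + 0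
  higher (suc i) _ = ℤP.*-zeroˡ (f (n ∸ suc i))

fibS : ℕ → FPS
fibS k n = + fib k n

Bk⊛fibS : ∀ k → Bk k ⊛ fibS k ≗ X
Bk⊛fibS k zero          = refl
Bk⊛fibS k (suc zero)    = cong (λ x → + 1 * + 1 + x) (ℤP.*-zeroʳ (- (+ k)))
Bk⊛fibS k (suc (suc n)) = begin
  (Bk k ⊛ fibS k) (2 ℕ.+ n)
    ≡⟨ quadratic-⊛-suc-suc (+ 1) (- (+ k)) (- (+ 1)) (fibS k) n ⟩
  + 1 * fibS k (2 ℕ.+ n) + (- (+ k) * fibS k (suc n) + - (+ 1) * fibS k n)
    ≡⟨ cong (λ x → + 1 * x + (- (+ k) * fibS k (suc n) + - (+ 1) * fibS k n)) fib-recurrence ⟩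
  + 1 * (+ k * fibS k (suc n) + fibS k n) + (- (+ k) * fibS k (suc n) + - (+ 1) * fibS k n)
                                                                         ≡⟨ cancel (+ k) (fibS k (suc n)) (fibS k n) ⟩
  + 0                                                                    ∎
  where
  open ≡-Reasoning
  fib-recurrence : fibS k (2 ℕ.+ n) ≡ + k * fibS k (suc n) + fibS k n
  fib-recurrence = trans (ℤP.pos-+ (k ℕ.* fib k (suc n)) (fib k n)) (cong (_+ fibS k n) (ℤP.pos-* k (fib k (suc n))))
  cancel : ∀ k a b → + 1 * (k * a + b) + (- k * a + - (+ 1) * b) ≡ + 0
  cancel = solve-∀

Ak≗Bk⊖X : ∀ k → Ak k ≗ Bk k ⊖ X
Ak≗Bk⊖X k zero                = refl
Ak≗Bk⊖X k (suc zero)          = neg-distrib (+ k)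
  where
  neg-distrib : ∀ x → - (+ 1 + x) ≡ - x - + 1
  neg-distrib = solve-∀
Ak≗Bk⊖X k (suc (suc zero))    = refl
Ak≗Bk⊖X k (suc (suc (suc n))) = refl

Wk≗fibS : ∀ k → Wk k ≗ fibS k
Wk≗fibS k = begin
  X ⊛ inv (Bk k)             ≈⟨ ⊛-cong {g = inv (Bk k)} (Bk⊛fibS k) (λ _ → refl) ⟨
  Bk k ⊛ fibS k ⊛ inv (Bk k) ≈⟨ a⊛f≗g⇒f≗g⊛a⁻¹ (Bk k) (inv (Bk k)) _ _ (⊛-inverseʳ (Bk k) refl) (λ _ → refl) ⟨
  fibS k                     ∎
  where open ≗-Reasoning

Wk-powS : ∀ k m s → m ≤ s → powS (Wk k) m s ≡ convFib k m (s ∸ m ℕ.+ 1)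
Wk-powS k m s m≤s = begin
  powS (X ⊛ inv (Bk k)) m s          ≡⟨ powS-⊛ X (inv (Bk k)) m s ⟩
  (powS X m ⊛ powS (inv (Bk k)) m) s ≡⟨ powS-X-⊛ m (powS (inv (Bk k)) m) s m≤s ⟩
  powS (inv (Bk k)) m (s ∸ m)        ≡⟨ cong (powS (inv (Bk k)) m) (ℕP.m+n∸n≡m (s ∸ m) 1) ⟨
  convFib k m (s ∸ m ℕ.+ 1)          ∎
  where open ≡-Reasoning

-- The generating function of k-Fibonacci paths

module PathSeries (k : ℕ) (a : ℕ → ℕ) (a↔KFibPath : ∀ i → Fin (a i) ↔ KFibPath k i) where

  Tk : FPS
  Tk i = + a i

  Tk-equation : Tk ≗ oneS ⊕ (fibS k ⊛ Tk ⊕ Z2 ⊛ (Tk ⊛ Tk))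
  Tk-equation n = begin
    + a n
      ≡⟨ cong +_ (pathCount-recurrence k a a↔KFibPath n) ⟩
    + (δℕ n ℕ.+ (convℕ (fib k) a n ℕ.+ shift₂ℕ (convℕ a a) n))
      ≡⟨ ℤP.pos-+ (δℕ n) _ ⟩
    + δℕ n + + (convℕ (fib k) a n ℕ.+ shift₂ℕ (convℕ a a) n)
      ≡⟨ cong (λ x → + δℕ n + x) (ℤP.pos-+ (convℕ (fib k) a n) _) ⟩
    + δℕ n + (+ convℕ (fib k) a n + + shift₂ℕ (convℕ a a) n)
      ≡⟨ cong₂ _+_ (pos-δℕ n) (cong₂ _+_ (pos-convℕ (fib k) a n) (pos-shift₂ℕ (convℕ a a) n)) ⟩
    oneS n + ((fibS k ⊛ Tk) n + (Z2 ⊛ (+_ ∘ convℕ a a)) n)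
      ≡⟨ cong (λ x → oneS n + ((fibS k ⊛ Tk) n + x)) (⊛-cong {Z2} (λ _ → refl) (pos-convℕ a a) n) ⟩
    oneS n + ((fibS k ⊛ Tk) n + (Z2 ⊛ (Tk ⊛ Tk)) n) ∎
    where open ≡-Reasoning

  Tk-defect : Tk ⊖ (oneS ⊕ (fibS k ⊛ Tk ⊕ Z2 ⊛ (Tk ⊛ Tk))) ≗ zeroS
  Tk-defect n = ℤP.i≡j⇒i-j≡0 (Tk-equation n)

  Tk⊛[1-W-z²Tk]≗1 : Tk ⊛ (oneS ⊖ Wk k ⊖ Z2 ⊛ Tk) ≗ oneS
  Tk⊛[1-W-z²Tk]≗1 = begin
    Tk ⊛ (oneS ⊖ Wk k ⊖ Z2 ⊛ Tk)
      ≈⟨ ⊛-cong {Tk} (λ _ → refl) (⊖-cong {g = Z2 ⊛ Tk} (⊖-cong {oneS} (λ _ → refl) (Wk≗fibS k)) (λ _ → refl)) ⟩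
    Tk ⊛ (oneS ⊖ fibS k ⊖ Z2 ⊛ Tk)
      ≈⟨ expand Tk (fibS k) Z2 ⟩
    oneS ⊕ (Tk ⊖ (oneS ⊕ (fibS k ⊛ Tk ⊕ Z2 ⊛ (Tk ⊛ Tk))))
      ≈⟨ ⊕-cong {oneS} (λ _ → refl) Tk-defect ⟩
    oneS ⊕ zeroS
      ≈⟨ (λ n → ℤP.+-identityʳ (oneS n)) ⟩
    oneS ∎
    where
    open ≗-Reasoning
    expand : ∀ t f z → t ⊛ (oneS ⊖ f ⊖ z ⊛ t) ≗ oneS ⊕ (t ⊖ (oneS ⊕ (f ⊛ t ⊕ z ⊛ (t ⊛ t))))
    expand = solve 3 (λ t f z → t :* (con (+ 1) :- f :- z :* t) := con (+ 1) :+ (t :- (con (+ 1) :+ (f :* t :+ z :* (t :* t)))))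
                     (λ _ → refl)

  Tk-quadratic : Z2 ⊛ Bk k ⊛ Tk ⊛ Tk ⊖ Ak k ⊛ Tk ⊕ Bk k ≗ zeroS
  Tk-quadratic = begin
    Z2 ⊛ B ⊛ Tk ⊛ Tk ⊖ Ak k ⊛ Tk ⊕ B
      ≈⟨ ⊕-cong {g = B} (⊖-cong {Z2 ⊛ B ⊛ Tk ⊛ Tk} (λ _ → refl) (⊛-cong {g = Tk} (Ak≗Bk⊖X k) (λ _ → refl))) (λ _ → refl) ⟩
    Z2 ⊛ B ⊛ Tk ⊛ Tk ⊖ (B ⊖ X) ⊛ Tk ⊕ B
      ≈⟨ regroup Z2 B Tk X (fibS k) ⟩
    negS (B ⊛ (Tk ⊖ (oneS ⊕ (fibS k ⊛ Tk ⊕ Z2 ⊛ (Tk ⊛ Tk))))) ⊕ (X ⊖ B ⊛ fibS k) ⊛ Tk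
        ≈⟨ ⊕-cong (λ n → cong -_ (⊛-cong {B} (λ _ → refl) Tk-defect n)) (⊛-cong {g = Tk} X⊖B⊛fibS≗0 (λ _ → refl)) ⟩
    negS (B ⊛ zeroS) ⊕ zeroS ⊛ Tk ≈⟨ (λ n → cong₂ (λ u v → - u + v) (⊛-zeroʳ B n) (⊛-zeroˡ Tk n)) ⟩
    zeroS                         ∎
    where
    open ≗-Reasoning
    B = Bk k
    X⊖B⊛fibS≗0 : X ⊖ B ⊛ fibS k ≗ zeroS
    X⊖B⊛fibS≗0 n = ℤP.i≡j⇒i-j≡0 (sym (Bk⊛fibS k n))
    regroup : ∀ z b t x f → z ⊛ b ⊛ t ⊛ t ⊖ (b ⊖ x) ⊛ t ⊕ b
                            ≗ negS (b ⊛ (t ⊖ (oneS ⊕ (f ⊛ t ⊕ z ⊛ (t ⊛ t))))) ⊕ (x ⊖ b ⊛ f) ⊛ t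
    regroup = solve 5 (λ z b t x f → z :* b :* t :* t :- (b :- x) :* t :+ b
                                   := :- (b :* (t :- (con (+ 1) :+ (f :* t :+ z :* (t :* t))))) :+ (x :- b :* f) :* t)
                      (λ _ → refl)

  sqrtDisc : FPS
  sqrtDisc = Ak k ⊖ Denom k ⊛ Tk

  sqrtDisc-0 : sqrtDisc 0 ≡ + 1
  sqrtDisc-0 = refl

  sqrtDisc² : sqrtDisc ⊛ sqrtDisc ≗ Disc k
  sqrtDisc² = begin
    sqrtDisc ⊛ sqrtDisc
      ≈⟨ complete-square (Ak k) (Bk k) Tk Z2 ⟩
    Disc k ⊕ four ⊛ Z2 ⊛ Bk k ⊛ (Z2 ⊛ Bk k ⊛ Tk ⊛ Tk ⊖ Ak k ⊛ Tk ⊕ Bk k)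
      ≈⟨ ⊕-cong {Disc k} (λ _ → refl) (⊛-cong {four ⊛ Z2 ⊛ Bk k} (λ _ → refl) Tk-quadratic) ⟩
    Disc k ⊕ four ⊛ Z2 ⊛ Bk k ⊛ zeroS
      ≈⟨ (λ n → trans (cong (λ x → Disc k n + x) (⊛-zeroʳ (four ⊛ Z2 ⊛ Bk k) n)) (ℤP.+-identityʳ (Disc k n))) ⟩
    Disc k ∎
    where
    open ≗-Reasoning
    four = constS (+ 4)
    complete-square : ∀ a b t z → (a ⊖ constS (+ 2) ⊛ z ⊛ b ⊛ t) ⊛ (a ⊖ constS (+ 2) ⊛ z ⊛ b ⊛ t)
                                  ≗ (a ⊛ a ⊖ four ⊛ z ⊛ b ⊛ b) ⊕ four ⊛ z ⊛ b ⊛ (z ⊛ b ⊛ t ⊛ t ⊖ a ⊛ t ⊕ b)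
    complete-square = solve 4 (λ a b t z → (a :- con (+ 2) :* z :* b :* t) :* (a :- con (+ 2) :* z :* b :* t)
                                         := (a :* a :- con (+ 4) :* z :* b :* b) :+ con (+ 4) :* z :* b :* (z :* b :* t :* t :- a :* t :+ b))
                              (λ _ → refl)

  sqrt-unique : ∀ S → S 0 ≡ + 1 → S ⊛ S ≗ Disc k → S ≗ sqrtDisc
  sqrt-unique S S0≡1 S²≗Disc = [f⊖h]⊛g≗0⇒f≗h S sqrtDisc (S ⊕ sqrtDisc) constant≢0 (begin
    (S ⊖ sqrtDisc) ⊛ (S ⊕ sqrtDisc) ≈⟨ difference-of-squares S sqrtDisc ⟩
    S ⊛ S ⊖ sqrtDisc ⊛ sqrtDisc     ≈⟨ ⊖-cong S²≗Disc sqrtDisc² ⟩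
    Disc k ⊖ Disc k                 ≈⟨ (λ n → ℤP.+-inverseʳ (Disc k n)) ⟩
    zeroS                           ∎)
    where
    open ≗-Reasoning
    constant≢0 : (S ⊕ sqrtDisc) 0 ≢ + 0
    constant≢0 eq with trans (sym (cong (_+ + 1) S0≡1)) eq
    ... | ()
    difference-of-squares : ∀ s r → (s ⊖ r) ⊛ (s ⊕ r) ≗ s ⊛ s ⊖ r ⊛ r
    difference-of-squares = solve 2 (λ s r → (s :- r) :* (s :+ r) := s :* s :- r :* r) (λ _ → refl)

  Denom⊛Tk≗Ak⊖sqrt : ∀ S → S 0 ≡ + 1 → S ⊛ S ≗ Disc k → Denom k ⊛ Tk ≗ Ak k ⊖ S
  Denom⊛Tk≗Ak⊖sqrt S S0≡1 S²≗Disc n =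
    trans (solve-for-d (Ak k n) ((Denom k ⊛ Tk) n)) (cong (λ s → Ak k n - s) (sym (sqrt-unique S S0≡1 S²≗Disc n)))
    where
    solve-for-d : ∀ a d → d ≡ a - (a - d)
    solve-for-d = solve-∀

  Tk≗inv : Tk ≗ inv (oneS ⊖ Wk k ⊖ Z2 ⊛ Tk)
  Tk≗inv n = inv-unique g Tk refl (λ m → trans (⊛-comm g Tk m) (Tk⊛[1-W-z²Tk]≗1 m)) n
    where g = oneS ⊖ Wk k ⊖ Z2 ⊛ Tk

  cfTrunc-agreeBelow : ∀ n → AgreeBelow (n ℕ.+ n) (cfTrunc k n) Tk
  cfTrunc-agreeBelow zero    i ()
  cfTrunc-agreeBelow (suc n) i i<2n+2 =
    trans (inv-agreeBelow (2 ℕ.+ (n ℕ.+ n)) step i (subst (i <_) (cong suc (ℕP.+-suc n n)) i<2n+2)) (sym (Tk≗inv i))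
    where
    step : AgreeBelow (2 ℕ.+ (n ℕ.+ n)) (oneS ⊖ Wk k ⊖ Z2 ⊛ cfTrunc k n) (oneS ⊖ Wk k ⊖ Z2 ⊛ Tk)
    step j j<d = cong (λ x → (oneS ⊖ Wk k) j - x) (Z2-⊛-agreeBelow (n ℕ.+ n) (cfTrunc-agreeBelow n) j j<d)

  cfTrunc-converges : ∀ t → ∃[ N ] (∀ n → N ≤ n → cfTrunc k n t ≡ Tk t)
  cfTrunc-converges t = suc t , λ n t<n → cfTrunc-agreeBelow n t (ℕP.<-≤-trans t<n (ℕP.m≤m+n n n))

  u : FPS
  u = inv (oneS ⊖ Wk k)

  [1-W]⊛u≗1 : (oneS ⊖ Wk k) ⊛ u ≗ oneS
  [1-W]⊛u≗1 = ⊛-inverseʳ (oneS ⊖ Wk k) refl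

  z²u² : FPS
  z²u² = Z2 ⊛ u ⊛ u

  module AtZ²u² = Substitution z²u² refl
  module AtW = Substitution (Wk k) refl

  catalanAtZ²u² : FPS
  catalanAtZ²u² = AtZ²u².substitute catalanS

  catalanAtZ²u²-equation : catalanAtZ²u² ≗ oneS ⊕ z²u² ⊛ (catalanAtZ²u² ⊛ catalanAtZ²u²)
  catalanAtZ²u²-equation = begin
    AtZ²u².substitute catalanS
      ≈⟨ AtZ²u².substitute-cong catalanS-equation ⟩
    AtZ²u².substitute (oneS ⊕ X ⊛ (catalanS ⊛ catalanS))
      ≈⟨ AtZ²u².substitute-⊕ oneS _ ⟩
    AtZ²u².substitute oneS ⊕ AtZ²u².substitute (X ⊛ (catalanS ⊛ catalanS))
      ≈⟨ ⊕-cong (AtZ²u².substitute-constS (+ 1)) (AtZ²u².substitute-X⊛ (catalanS ⊛ catalanS)) ⟩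
    oneS ⊕ z²u² ⊛ AtZ²u².substitute (catalanS ⊛ catalanS)
      ≈⟨ ⊕-cong {oneS} (λ _ → refl) (⊛-cong {z²u²} (λ _ → refl) (AtZ²u².substitute-⊛ catalanS catalanS)) ⟩
    oneS ⊕ z²u² ⊛ (catalanAtZ²u² ⊛ catalanAtZ²u²) ∎
    where open ≗-Reasoning

  V : FPS
  V = u ⊛ catalanAtZ²u²

  V⊛[1-W-z²V]≗1 : V ⊛ (oneS ⊖ Wk k ⊖ Z2 ⊛ V) ≗ oneS
  V⊛[1-W-z²V]≗1 = begin
    V ⊛ (oneS ⊖ Wk k ⊖ Z2 ⊛ V)               ≈⟨ regroup u (Wk k) E Z2 ⟩
    E ⊛ ((oneS ⊖ Wk k) ⊛ u) ⊖ z²u² ⊛ (E ⊛ E) ≈⟨ ⊖-cong {g = z²u² ⊛ (E ⊛ E)} (⊛-cong {E} (λ _ → refl) [1-W]⊛u≗1) (λ _ → refl) ⟩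
    E ⊛ oneS ⊖ z²u² ⊛ (E ⊛ E)                ≈⟨ ⊖-cong {g = z²u² ⊛ (E ⊛ E)} (⊛-identityʳ E) (λ _ → refl) ⟩
    E ⊖ z²u² ⊛ (E ⊛ E)                       ≈⟨ ⊖-cong {g = z²u² ⊛ (E ⊛ E)} catalanAtZ²u²-equation (λ _ → refl) ⟩
    oneS ⊕ z²u² ⊛ (E ⊛ E) ⊖ z²u² ⊛ (E ⊛ E)   ≈⟨ (λ n → cancel (oneS n) ((z²u² ⊛ (E ⊛ E)) n)) ⟩
    oneS                                     ∎
    where
    open ≗-Reasoning
    E = catalanAtZ²u²
    regroup : ∀ u w e z → (u ⊛ e) ⊛ (oneS ⊖ w ⊖ z ⊛ (u ⊛ e)) ≗ e ⊛ ((oneS ⊖ w) ⊛ u) ⊖ z ⊛ u ⊛ u ⊛ (e ⊛ e)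
    regroup = solve 4 (λ u w e z → (u :* e) :* (con (+ 1) :- w :- z :* (u :* e))
                                 := e :* ((con (+ 1) :- w) :* u) :- z :* u :* u :* (e :* e))
                      (λ _ → refl)
    cancel : ∀ a b → a + b - b ≡ a
    cancel = solve-∀

  Tk≗V : Tk ≗ V
  Tk≗V = [f⊖h]⊛g≗0⇒f≗h Tk V (oneS ⊖ Wk k ⊖ Z2 ⊛ (Tk ⊕ V)) (λ ()) (begin
    (Tk ⊖ V) ⊛ (oneS ⊖ Wk k ⊖ Z2 ⊛ (Tk ⊕ V))                  ≈⟨ split Tk V (Wk k) Z2 ⟩
    Tk ⊛ (oneS ⊖ Wk k ⊖ Z2 ⊛ Tk) ⊖ V ⊛ (oneS ⊖ Wk k ⊖ Z2 ⊛ V) ≈⟨ ⊖-cong Tk⊛[1-W-z²Tk]≗1 V⊛[1-W-z²V]≗1 ⟩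
    oneS ⊖ oneS                                               ≈⟨ (λ n → ℤP.+-inverseʳ (oneS n)) ⟩
    zeroS                                                     ∎)
    where
    open ≗-Reasoning
    split : ∀ t v w z → (t ⊖ v) ⊛ (oneS ⊖ w ⊖ z ⊛ (t ⊕ v)) ≗ t ⊛ (oneS ⊖ w ⊖ z ⊛ t) ⊖ v ⊛ (oneS ⊖ w ⊖ z ⊛ v)
    split = solve 4 (λ t v w z → (t :- v) :* (con (+ 1) :- w :- z :* (t :+ v))
                               := t :* (con (+ 1) :- w :- z :* t) :- v :* (con (+ 1) :- w :- z :* v))
                    (λ _ → refl)

  geometricAtW≗u : AtW.substitute geometricS ≗ u
  geometricAtW≗u = inv-unique (oneS ⊖ Wk k) (AtW.substitute geometricS) refl (begin
    (oneS ⊖ Wk k) ⊛ AtW.substitute geometricS             ≈⟨ ⊛-cong {g = AtW.substitute geometricS} 1-X-at-W (λ _ → refl) ⟨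
    AtW.substitute (oneS ⊖ X) ⊛ AtW.substitute geometricS ≈⟨ AtW.substitute-⊛ (oneS ⊖ X) geometricS ⟨
    AtW.substitute ((oneS ⊖ X) ⊛ geometricS)              ≈⟨ AtW.substitute-cong 1-X⊛geometricS ⟩
    AtW.substitute oneS                                   ≈⟨ AtW.substitute-constS (+ 1) ⟩
    oneS                                                  ∎)
    where
    open ≗-Reasoning
    X-at-W : AtW.substitute X ≗ Wk k
    X-at-W = begin
      AtW.substitute X           ≈⟨ AtW.substitute-cong (⊛-identityʳ X) ⟨
      AtW.substitute (X ⊛ oneS)  ≈⟨ AtW.substitute-X⊛ oneS ⟩
      Wk k ⊛ AtW.substitute oneS ≈⟨ ⊛-cong {Wk k} (λ _ → refl) (AtW.substitute-constS (+ 1)) ⟩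
      Wk k ⊛ oneS                ≈⟨ ⊛-identityʳ (Wk k) ⟩
      Wk k                       ∎
    1-X-at-W : AtW.substitute (oneS ⊖ X) ≗ oneS ⊖ Wk k
    1-X-at-W = begin
      AtW.substitute (oneS ⊖ X)              ≈⟨ AtW.substitute-⊖ oneS X ⟩
      AtW.substitute oneS ⊖ AtW.substitute X ≈⟨ ⊖-cong (AtW.substitute-constS (+ 1)) X-at-W ⟩
      oneS ⊖ Wk k                            ∎

  u-powS : ∀ r → powS u (suc r) ≗ AtW.substitute (binomialS r)
  u-powS zero = begin
    u ⊛ oneS                     ≈⟨ ⊛-identityʳ u ⟩
    u                            ≈⟨ geometricAtW≗u ⟨
    AtW.substitute geometricS    ≈⟨ AtW.substitute-cong binomialS-zero ⟨
    AtW.substitute (binomialS 0) ∎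
    where open ≗-Reasoning
  u-powS (suc r) = begin
    u ⊛ powS u (suc r)                                       ≈⟨ ⊛-cong (λ n → sym (geometricAtW≗u n)) (u-powS r) ⟩
    AtW.substitute geometricS ⊛ AtW.substitute (binomialS r) ≈⟨ ⊛-comm (AtW.substitute geometricS) (AtW.substitute (binomialS r)) ⟩
    AtW.substitute (binomialS r) ⊛ AtW.substitute geometricS ≈⟨ AtW.substitute-⊛ (binomialS r) geometricS ⟨
    AtW.substitute (binomialS r ⊛ geometricS)                ≈⟨ AtW.substitute-cong (binomialS-suc r) ⟨
    AtW.substitute (binomialS (suc r))                       ∎
    where open ≗-Reasoning

  z²u²-powS⊛u : ∀ n → powS z²u² n ⊛ u ≗ powS X (2 ℕ.* n) ⊛ powS u (suc (2 ℕ.* n))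
  z²u²-powS⊛u zero    = ⊛-cong {oneS} (λ _ → refl) (λ i → sym (⊛-identityʳ u i))
  z²u²-powS⊛u (suc n) = begin
    z²u² ⊛ powS z²u² n ⊛ u
      ≈⟨ ⊛-assoc z²u² (powS z²u² n) u ⟩
    z²u² ⊛ (powS z²u² n ⊛ u)
      ≈⟨ ⊛-cong {z²u²} (λ _ → refl) (z²u²-powS⊛u n) ⟩
    z²u² ⊛ (powS X (2 ℕ.* n) ⊛ powS u (suc (2 ℕ.* n)))
      ≈⟨ ⊛-cong {g = powS X (2 ℕ.* n) ⊛ powS u (suc (2 ℕ.* n))} (⊛-cong {g = u} (⊛-cong {g = u} Z2≗X⊛X (λ _ → refl)) (λ _ → refl)) (λ _ → refl) ⟩
    (X ⊛ X) ⊛ u ⊛ u ⊛ (powS X (2 ℕ.* n) ⊛ powS u (suc (2 ℕ.* n)))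
      ≈⟨ regroup X u (powS X (2 ℕ.* n)) (powS u (suc (2 ℕ.* n))) ⟩
    powS X (2 ℕ.+ 2 ℕ.* n) ⊛ powS u (3 ℕ.+ 2 ℕ.* n)
      ≈⟨ (λ t → cong (λ j → (powS X j ⊛ powS u (suc j)) t) (sym (2[1+n]≡2+2n n))) ⟩
    powS X (2 ℕ.* suc n) ⊛ powS u (suc (2 ℕ.* suc n)) ∎
    where
    open ≗-Reasoning
    regroup : ∀ X u p q → (X ⊛ X) ⊛ u ⊛ u ⊛ (p ⊛ q) ≗ (X ⊛ (X ⊛ p)) ⊛ (u ⊛ (u ⊛ q))
    regroup = solve 4 (λ X u p q → (X :* X) :* u :* u :* (p :* q) := (X :* (X :* p)) :* (u :* (u :* q))) (λ _ → refl)

  u⊛z²u²-powS-low : ∀ n t → t < 2 ℕ.* n → (u ⊛ powS z²u² n) t ≡ + 0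
  u⊛z²u²-powS-low n t t<2n =
    trans (⊛-comm u (powS z²u² n) t) (trans (z²u²-powS⊛u n t) (powS-X-⊛-low (2 ℕ.* n) (powS u (suc (2 ℕ.* n))) t t<2n))

  u⊛z²u²-powS-high : ∀ n t → 2 ℕ.* n ≤ t →
    (u ⊛ powS z²u² n) t ≡ sumTo (t ∸ 2 ℕ.* n) (λ m → + ((m ℕ.+ 2 ℕ.* n) C m) * convFib k m (t ∸ 2 ℕ.* n ∸ m ℕ.+ 1))
  u⊛z²u²-powS-high n t 2n≤t = begin
    (u ⊛ powS z²u² n) t
      ≡⟨ ⊛-comm u (powS z²u² n) t ⟩
    (powS z²u² n ⊛ u) t
      ≡⟨ z²u²-powS⊛u n t ⟩
    (powS X (2 ℕ.* n) ⊛ powS u (suc (2 ℕ.* n))) t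
      ≡⟨ powS-X-⊛ (2 ℕ.* n) (powS u (suc (2 ℕ.* n))) t 2n≤t ⟩
    powS u (suc (2 ℕ.* n)) s
      ≡⟨ u-powS (2 ℕ.* n) s ⟩
    sumTo s (λ m → binomialS (2 ℕ.* n) m * powS (Wk k) m s)
      ≡⟨ sumTo-cong s (λ m m≤s → cong (binomialS (2 ℕ.* n) m *_) (Wk-powS k m s m≤s)) ⟩
    sumTo s (λ m → + ((m ℕ.+ 2 ℕ.* n) C m) * convFib k m (s ∸ m ℕ.+ 1)) ∎
    where
    open ≡-Reasoning
    s = t ∸ 2 ℕ.* n

  coefficient-term : ∀ t n → catalanS n * (u ⊛ powS z²u² n) t ≡
    (if 2 ℕ.* n ≤ᵇ t
     then sumTo (t ∸ 2 ℕ.* n) (λ m → + ((m ℕ.+ 2 ℕ.* n) C m) * + catalan n * convFib k m (t ∸ 2 ℕ.* n ∸ m ℕ.+ 1))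
     else + 0)
  coefficient-term t n with 2 ℕ.* n ≤ᵇ t in 2n≤ᵇt
  ... | true  = trans (cong (catalanS n *_) (u⊛z²u²-powS-high n t (ℕP.≤ᵇ⇒≤ (2 ℕ.* n) t (subst T (sym 2n≤ᵇt) tt))))
                      (trans (sym (sumTo-*ˡ s (catalanS n) term)) (sumTo-ext s (λ m → reorder (catalanS n) (binomial m) (convolved m))))
    where
    s = t ∸ 2 ℕ.* n
    binomial : ℕ → ℤ
    binomial m = + ((m ℕ.+ 2 ℕ.* n) C m)
    convolved : ℕ → ℤ
    convolved m = convFib k m (s ∸ m ℕ.+ 1)
    term : ℕ → ℤ
    term m = binomial m * convolved m
    reorder : ∀ c b f → c * (b * f) ≡ b * c * f
    reorder = solve-∀
  ... | false = trans (cong (catalanS n *_) (u⊛z²u²-powS-low n t (ℕP.≰⇒> 2n≰t))) (ℤP.*-zeroʳ (catalanS n))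
    where
    2n≰t : ¬ 2 ℕ.* n ≤ t
    2n≰t 2n≤t = subst T 2n≤ᵇt (ℕP.≤⇒≤ᵇ 2n≤t)

  Tk-coefficient : ∀ t → Tk t ≡ coeffFormula k t
  Tk-coefficient t = begin
    Tk t                                             ≡⟨ Tk≗V t ⟩
    (u ⊛ AtZ²u².substitute catalanS) t               ≡⟨ AtZ²u².⊛-substitute u catalanS t ⟩
    sumTo t (λ n → catalanS n * (u ⊛ powS z²u² n) t) ≡⟨ sumTo-ext t (coefficient-term t) ⟩
    coeffFormula k t                                 ∎
    where open ≡-Reasoning

theorem3p3 : (k : ℕ) → 1 ≤ k → (a : ℕ → ℕ) → (∀ i → Fin (a i) ↔ KFibPath k i) →
    (∃[ S ] (S 0 ≡ + 1 × (S ⊛ S) ≗ Disc k))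
    × (∀ (S : FPS) → S 0 ≡ + 1 → (S ⊛ S) ≗ Disc k →
         (Denom k ⊛ (λ i → + a i)) ≗ (Ak k ⊖ S))
    × (∀ (t : ℕ) → ∃[ N ] (∀ n → N ≤ n → cfTrunc k n t ≡ + a t))
    × (∀ (t : ℕ) → + a t ≡ coeffFormula k t)
theorem3p3 k _ a a↔KFibPath =
    (sqrtDisc , sqrtDisc-0 , sqrtDisc²)
  , Denom⊛Tk≗Ak⊖sqrt
  , cfTrunc-converges
  , Tk-coefficient
  where open PathSeries k a a↔KFibPath
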